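{- Let $(d_1,\ldots,d_n)$ be a tree degree sequence with $n\geq 3$, let $V=\{v_1,\ldots,v_n\}$, and let $X\subseteq V$ be such that (i) $d_i>1$ for every $v_i\in X$, (ii) $|X|\leq n/2$, and (iii) $\sum_{i:v_i\in X}d_i\geq \sum_{i:v_i\in V\setminus X}d_i$. Then there is a tree $T$ with vertex set $V(T)=V$ such that $d_T(v_i)=d_i$ for every $v_i\in V$, and $X$ is a minimum vertex cover of $T$.
   Context: All graphs are finite, simple and undirected. The degree sequence of a graph is the nonincreasing sequence of the degrees of its vertices; a tree degree sequence is the degree sequence of some tree (so $d_1\geq\cdots\geq d_n$). A vertex cover of a graph is a set of vertices meeting every edge; it is minimum if it has minimum cardinality. -}

module Defs where

open import Data.Nat using (ℕ; zero; suc; _+_; _≤_; _≥_; _*_)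
open import Data.Bool using (Bool; true; false; if_then_else_)
open import Data.Fin using (Fin; zero; suc)
open import Data.Fin.Subset using (Subset; _∈_; _∉_; ∣_∣)
open import Data.Fin.Permutation using (Permutation′; _⟨$⟩ʳ_)
open import Data.Vec using (Vec; []; _∷_)
open import Data.List using (List; []; _∷_; length; _∷ʳ_)
open import Data.List.Relation.Unary.Unique.Propositional using (Unique)
open import Data.List.Relation.Unary.Linked using (Linked)
open import Data.Product using (Σ; ∃; _×_)
open import Relation.Nullary using (¬_)
open import Relation.Binary.PropositionalEquality using (_≡_)

-- A finite simple graph on the vertex set Fin n (vertex i stands for v_{i+1}).
record Graph (n : ℕ) : Set where
  field
    adj     : Fin n → Fin n → Bool
    adj-sym : ∀ i j → adj i j ≡ adj j i
    irrefl  : ∀ i → adj i i ≡ false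
open Graph public

Adj : ∀ {n} → Graph n → Fin n → Fin n → Set
Adj G i j = adj G i j ≡ true

sumFin : ∀ {n} → (Fin n → ℕ) → ℕ
sumFin {zero}  f = 0
sumFin {suc n} f = f zero + sumFin (λ i → f (suc i))

sumIn : ∀ {n} → Subset n → (Fin n → ℕ) → ℕ
sumIn []          f = 0
sumIn (true ∷ X)  f = f zero + sumIn X (λ i → f (suc i))
sumIn (false ∷ X) f = sumIn X (λ i → f (suc i))

sumOut : ∀ {n} → Subset n → (Fin n → ℕ) → ℕ
sumOut []          f = 0
sumOut (true ∷ X)  f = sumOut X (λ i → f (suc i))
sumOut (false ∷ X) f = f zero + sumOut X (λ i → f (suc i))

deg : ∀ {n} → Graph n → Fin n → ℕ
deg G i = sumFin (λ j → if adj G i j then 1 else 0)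

data Walk {n} (G : Graph n) : Fin n → Fin n → Set where
  here : ∀ {u} → Walk G u u
  step : ∀ {u w v} → Adj G u w → Walk G w v → Walk G u v

Connected : ∀ {n} → Graph n → Set
Connected G = ∀ u v → Walk G u v

IsCycle : ∀ {n} → Graph n → List (Fin n) → Set
IsCycle G []       = Data.Empty.⊥ where import Data.Empty
IsCycle G (v ∷ vs) = Unique (v ∷ vs) × (2 ≤ length vs) × Linked (Adj G) ((v ∷ vs) ∷ʳ v)

Acyclic : ∀ {n} → Graph n → Set
Acyclic G = ∀ c → ¬ IsCycle G c

IsTree : ∀ {n} → Graph n → Set
IsTree G = Connected G × Acyclic G

Nonincreasing : ∀ {n} → (Fin n → ℕ) → Set
Nonincreasing {n} d = ∀ (i j : Fin n) → Data.Fin._≤_ i j → d j ≤ d i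
  where import Data.Fin

TreeDegreeSequence : (n : ℕ) → (Fin n → ℕ) → Set
TreeDegreeSequence n d =
  Nonincreasing d ×
  Σ (Graph n) (λ T → IsTree T × Σ (Permutation′ n) (λ π → ∀ i → deg T (π ⟨$⟩ʳ i) ≡ d i))

VertexCover : ∀ {n} → Graph n → Subset n → Set
VertexCover G X = ∀ i j → Adj G i j → i ∈ X Data.Sum.⊎ j ∈ X
  where import Data.Sum

MinimumVertexCover : ∀ {n} → Graph n → Subset n → Set
MinimumVertexCover {n} G X = VertexCover G X × (∀ (Y : Subset n) → VertexCover G Y → ∣ X ∣ ≤ ∣ Y ∣)

-- A rooted tree is a parent function that strictly decreases a rank, and one with the prescribed
-- degrees is grown by attaching vertices one at a time to free slots of already placed vertices.
-- Starting from a root in X, each round attaches an unplaced X-vertex x (of degree at least 3 if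
-- there is one), preferably to a free slot at a Y-vertex, and then an unplaced Y-vertex y (of degree
-- at least 2 if there is one) to x. When X is exhausted, the hypotheses |X| ≤ n/2 and Σ_X d ≥ Σ_Y d
-- guarantee that only Y-leaves remain and that all free slots sit at X-vertices; the leaves fill them.
-- Every edge then meets X, and the children y form a matching saturating X, so no vertex cover is
-- smaller than X.

module Submission where

open import Defs
open import Data.Nat using (ℕ; zero; suc; _+_; _*_; _∸_; _≤_; _<_; _≥_; z≤n; s≤s; _≤?_)
open import Data.Nat.Properties hiding (_≟_; suc-injective)
open import Data.Nat.Induction using (<-wellFounded)
open import Data.Nat.Solver using (module +-*-Solver)
open +-*-Solver using (solve; _:+_; _:=_; con)
open import Induction.WellFounded using (Acc; acc)
open import Data.Bool using (Bool; true; false; if_then_else_; not; _∧_; _∨_)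
import Data.Bool.Properties as Bool
open import Data.Fin using (Fin; zero; suc)
open import Data.Fin.Properties using (_≟_; suc-injective; any?)
open import Data.Fin.Permutation using (Permutation′; _⟨$⟩ʳ_)
open import Data.Fin.Subset using (Subset; _∈_; _∉_; ∣_∣)
open import Data.Vec using ([]; _∷_; lookup)
open import Data.Vec.Properties using ([]=⇒lookup; lookup⇒[]=)
open import Data.Vec.Functional using (updateAt)
open import Data.Vec.Functional.Properties using (updateAt-updates; updateAt-minimal)
open import Data.Product using (Σ; ∃; _×_; _,_; proj₁; proj₂)
open import Data.Sum as Sum using (_⊎_; inj₁; inj₂)
open import Data.Empty using (⊥; ⊥-elim)
open import Data.Unit using (⊤)
open import Data.List using (List; []; _∷_; _∷ʳ_; length)
open import Data.List.Relation.Unary.All as All using (All; []; _∷_)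
open import Data.List.Relation.Unary.AllPairs using (AllPairs; []; _∷_)
open import Data.List.Relation.Unary.Linked as Linked using (Linked; [-]; _∷_)
open import Function using (const)
open import Function.Bundles using (mk⇔)
open import Relation.Nullary using (¬_; Dec; does; yes; no)
open import Relation.Nullary.Decidable using (dec-true; dec-false; _×-dec_; _⊎-dec_)
open import Relation.Unary using (Decidable)
open import Relation.Binary.PropositionalEquality
import Algebra.Properties.CommutativeMonoid.Sum as CommutativeMonoidSum


when : Bool → ℕ → ℕ
when b x = if b then x else 0

𝟙 : Bool → ℕ
𝟙 b = when b 1

when-zero : ∀ b → when b 0 ≡ 0
when-zero true  = refl
when-zero false = refl

when-suc : ∀ b x → when b (suc x) ≡ when b x + 𝟙 b
when-suc true  x = +-comm 1 x
when-suc false x = refl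

when-complement : ∀ b x → when b x + when (not b) x ≡ x
when-complement true  x = +-identityʳ x
when-complement false x = refl

when-≤ : ∀ b x → when b x ≤ x
when-≤ true  x = ≤-refl
when-≤ false x = z≤n

when-distrib-+ : ∀ b x y → when b (x + y) ≡ when b x + when b y
when-distrib-+ true  x y = refl
when-distrib-+ false x y = refl

when-positive : ∀ {b x} → 1 ≤ when b x → b ≡ true × 1 ≤ x
when-positive {true} 1≤x = refl , 1≤x

𝟙≡0 : ∀ {b} → 𝟙 b ≡ 0 → b ≡ false
𝟙≡0 {false} _ = refl

𝟙-∨ : ∀ a b → (a ≡ true → b ≡ true → ⊥) → 𝟙 (a ∨ b) ≡ 𝟙 a + 𝟙 b
𝟙-∨ true  true  not-both = ⊥-elim (not-both refl refl)
𝟙-∨ true  false _        = refl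
𝟙-∨ false b     _        = refl

true≢false : true ≢ false
true≢false ()

_≡ᵇ_ : ∀ {n} → Fin n → Fin n → Bool
i ≡ᵇ j = does (i ≟ j)

sumFin-cong : ∀ {n} {f g : Fin n → ℕ} → (∀ i → f i ≡ g i) → sumFin f ≡ sumFin g
sumFin-cong {zero}  f≗g = refl
sumFin-cong {suc n} f≗g = cong₂ _+_ (f≗g zero) (sumFin-cong (λ i → f≗g (suc i)))

sumFin-mono : ∀ {n} {f g : Fin n → ℕ} → (∀ i → f i ≤ g i) → sumFin f ≤ sumFin g
sumFin-mono {zero}  f≤g = z≤n
sumFin-mono {suc n} f≤g = +-mono-≤ (f≤g zero) (sumFin-mono (λ i → f≤g (suc i)))

sumFin-distrib-+ : ∀ {n} (f g : Fin n → ℕ) →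
                   sumFin (λ i → f i + g i) ≡ sumFin f + sumFin g
sumFin-distrib-+ {zero}  f g = refl
sumFin-distrib-+ {suc n} f g
  rewrite sumFin-distrib-+ (λ i → f (suc i)) (λ i → g (suc i)) =
  solve 4 (λ a b c d → (a :+ b) :+ (c :+ d) := (a :+ c) :+ (b :+ d)) refl
          (f zero) (g zero) (sumFin (λ i → f (suc i))) (sumFin (λ i → g (suc i)))

sumFin-zero : ∀ n → sumFin {n} (λ _ → 0) ≡ 0
sumFin-zero zero    = refl
sumFin-zero (suc n) = sumFin-zero n

sumFin-one : ∀ n → sumFin {n} (λ _ → 1) ≡ n
sumFin-one zero    = refl
sumFin-one (suc n) = cong suc (sumFin-one n)

sumFin-comm : ∀ {m n} (f : Fin m → Fin n → ℕ) →
              sumFin (λ i → sumFin (f i)) ≡ sumFin (λ j → sumFin (λ i → f i j))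
sumFin-comm {zero}  {n} f = sym (sumFin-zero n)
sumFin-comm {suc m} f = begin
  sumFin (f zero) + sumFin (λ i → sumFin (f (suc i)))
    ≡⟨ cong (sumFin (f zero) +_) (sumFin-comm (λ i → f (suc i))) ⟩
  sumFin (f zero) + sumFin (λ j → sumFin (λ i → f (suc i) j))
    ≡⟨ sumFin-distrib-+ (f zero) _ ⟨
  sumFin (λ j → f zero j + sumFin (λ i → f (suc i) j)) ∎
  where open ≡-Reasoning

term≤sumFin : ∀ {n} (f : Fin n → ℕ) i → f i ≤ sumFin f
term≤sumFin f zero    = m≤m+n (f zero) _
term≤sumFin f (suc i) = ≤-trans (term≤sumFin (λ j → f (suc j)) i) (m≤n+m _ (f zero))

sumFin≡0 : ∀ {n} (f : Fin n → ℕ) → sumFin f ≡ 0 → ∀ i → f i ≡ 0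
sumFin≡0 f Σ≡0 i = n≤0⇒n≡0 (subst (f i ≤_) Σ≡0 (term≤sumFin f i))

sumFin-positive : ∀ {n} (f : Fin n → ℕ) → 1 ≤ sumFin f → ∃ λ i → 1 ≤ f i
sumFin-positive {suc n} f 1≤Σ with f zero in eq
... | suc _ = zero , subst (1 ≤_) (sym eq) (s≤s z≤n)
... | zero  with sumFin-positive (λ i → f (suc i)) 1≤Σ
...   | i , 1≤fi = suc i , 1≤fi

sumFin-agree-except : ∀ {n} (f g : Fin n → ℕ) k → (∀ i → i ≢ k → f i ≡ g i) →
                      sumFin g + f k ≡ sumFin f + g k
sumFin-agree-except f g zero f≗g
  rewrite sumFin-cong {f = λ i → g (suc i)} (λ i → sym (f≗g (suc i) λ ())) =
  solve 3 (λ a b c → (a :+ b) :+ c := (c :+ b) :+ a) refl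
          (g zero) (sumFin (λ i → f (suc i))) (f zero)
sumFin-agree-except f g (suc k) f≗g
  rewrite f≗g zero (λ ())
        | +-assoc (g zero) (sumFin (λ i → g (suc i))) (f (suc k))
        | sumFin-agree-except (λ i → f (suc i)) (λ i → g (suc i)) k
            (λ i i≢k → f≗g (suc i) (λ eq → i≢k (suc-injective eq)))
        = sym (+-assoc (g zero) _ _)

sumFin-point : ∀ {n} (k : Fin n) x → sumFin (λ i → when (k ≡ᵇ i) x) ≡ x
sumFin-point {suc n} zero x = trans (cong (x +_) (sumFin-zero n)) (+-identityʳ x)
sumFin-point {suc n} (suc k) x = trans (sumFin-cong shift) (sumFin-point k x)
  where
  shift : ∀ i → when (suc k ≡ᵇ suc i) x ≡ when (k ≡ᵇ i) x
  shift i with k ≟ i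
  ... | yes _ = refl
  ... | no  _ = refl

sumFin-permute : ∀ {n} (f : Fin n → ℕ) (π : Permutation′ n) →
                 sumFin (λ i → f (π ⟨$⟩ʳ i)) ≡ sumFin f
sumFin-permute f π = begin
  sumFin (λ i → f (π ⟨$⟩ʳ i)) ≡⟨ sumFin≡sum (λ i → f (π ⟨$⟩ʳ i)) ⟩
  ℕΣ.sum (λ i → f (π ⟨$⟩ʳ i)) ≡⟨ ℕΣ.sum-permute f π ⟨
  ℕΣ.sum f                    ≡⟨ sumFin≡sum f ⟨
  sumFin f                    ∎
  where
  open ≡-Reasoning
  module ℕΣ = CommutativeMonoidSum +-0-commutativeMonoid
  sumFin≡sum : ∀ {n} (f : Fin n → ℕ) → sumFin f ≡ ℕΣ.sum f
  sumFin≡sum {zero}  f = refl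
  sumFin≡sum {suc n} f = cong (f zero +_) (sumFin≡sum (λ i → f (suc i)))

sumFin-when-split : ∀ {n} (b : Fin n → Bool) (f : Fin n → ℕ) →
  sumFin (λ i → when (b i) (f i)) + sumFin (λ i → when (not (b i)) (f i)) ≡ sumFin f
sumFin-when-split b f =
  trans (sym (sumFin-distrib-+ (λ i → when (b i) (f i)) (λ i → when (not (b i)) (f i))))
        (sumFin-cong (λ i → when-complement (b i) (f i)))

sumFin-≢ : ∀ {n} (r : Fin n) → sumFin (λ i → 𝟙 (not (i ≡ᵇ r))) + 1 ≡ n
sumFin-≢ {n} r = begin
  sumFin (λ i → 𝟙 (not (i ≡ᵇ r))) + 1
    ≡⟨ sumFin-agree-except (λ _ → 1) (λ i → 𝟙 (not (i ≡ᵇ r))) r ≢r-one ⟩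
  sumFin {n} (λ _ → 1) + 𝟙 (not (r ≡ᵇ r))
    ≡⟨ cong₂ _+_ (sumFin-one n) (cong (λ b → 𝟙 (not b)) (dec-true (r ≟ r) refl)) ⟩
  n + 0
    ≡⟨ +-identityʳ n ⟩
  n ∎
  where
  open ≡-Reasoning
  ≢r-one : ∀ i → i ≢ r → 1 ≡ 𝟙 (not (i ≡ᵇ r))
  ≢r-one i i≢r = cong (λ b → 𝟙 (not b)) (sym (dec-false (i ≟ r) i≢r))

module _ {A : Set} where

  NonBacktracking : List A → Set
  NonBacktracking (a ∷ b ∷ c ∷ rest) = a ≢ c × NonBacktracking (b ∷ c ∷ rest)
  NonBacktracking _                  = ⊤

  -- In a list written a ∷ ws ∷ʳ z, second z ws is the entry after a and penultimate a ws the one before z.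
  second : A → List A → A
  second z []      = z
  second z (b ∷ _) = b

  penultimate : A → List A → A
  penultimate a []       = a
  penultimate a (b ∷ bs) = penultimate b bs

  linked-second : ∀ {R : A → A → Set} a ws z → Linked R (a ∷ ws ∷ʳ z) → R a (second z ws)
  linked-second a []      z (Rab ∷ _) = Rab
  linked-second a (b ∷ _) z (Rab ∷ _) = Rab

  nonBacktracking-second : ∀ a b ws z → NonBacktracking (a ∷ b ∷ ws ∷ʳ z) → a ≢ second z ws
  nonBacktracking-second a b []      z (a≢z , _) = a≢z
  nonBacktracking-second a b (_ ∷ _) z (a≢c , _) = a≢c

  nonBacktracking-tail : ∀ a b ws z → NonBacktracking (a ∷ b ∷ ws ∷ʳ z) →
                         NonBacktracking (b ∷ ws ∷ʳ z)
  nonBacktracking-tail a b []      z (_ , nb) = nb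
  nonBacktracking-tail a b (_ ∷ _) z (_ , nb) = nb

  nonBacktracking-∷ʳ : ∀ ws v → AllPairs _≢_ ws → All (v ≢_) ws → NonBacktracking (ws ∷ʳ v)
  nonBacktracking-∷ʳ []               v _                   _                = _
  nonBacktracking-∷ʳ (a ∷ [])         v _                   _                = _
  nonBacktracking-∷ʳ (a ∷ b ∷ [])     v _                   (v≢a ∷ _)        = ≢-sym v≢a , _
  nonBacktracking-∷ʳ (a ∷ b ∷ c ∷ ws) v ((_ ∷ a≢c ∷ _) ∷ u) (_ ∷ v≢ws)    =
    a≢c , nonBacktracking-∷ʳ (b ∷ c ∷ ws) v u v≢ws

  ≢-penultimate : ∀ {b} c rest → All (b ≢_) (c ∷ rest) → b ≢ penultimate c rest
  ≢-penultimate c []         (b≢c ∷ _)  = b≢c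
  ≢-penultimate c (d ∷ rest) (_ ∷ b≢ds) = ≢-penultimate d rest b≢ds

module _ {n} {G : Graph n} where

  _++ʷ_ : ∀ {a b c} → Walk G a b → Walk G b c → Walk G a c
  here     ++ʷ q = q
  step e w ++ʷ q = step e (w ++ʷ q)

  reverseʷ : ∀ {a b} → Walk G a b → Walk G b a
  reverseʷ here               = here
  reverseʷ (step {a} {b} e w) = reverseʷ w ++ʷ step (trans (adj-sym G b a) e) here

  lengthʷ : ∀ {a b} → Walk G a b → ℕ
  lengthʷ here       = 0
  lengthʷ (step _ w) = suc (lengthʷ w)

  vertices : ∀ {a b} → Walk G a b → List (Fin n)
  vertices (here {a})     = a ∷ []
  vertices (step {a} _ w) = a ∷ vertices w

  linked-vertices : ∀ {R : Fin n → Fin n → Set} {a b c} → (∀ {x y} → Adj G x y → R x y) →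
                    (w : Walk G a b) → R b c → Linked R (vertices w ∷ʳ c)
  linked-vertices adj⇒R here                    Rbc = Rbc ∷ [-]
  linked-vertices adj⇒R (step e here)           Rbc = adj⇒R e ∷ Rbc ∷ [-]
  linked-vertices adj⇒R (step e w@(step _ _))   Rbc = adj⇒R e ∷ linked-vertices adj⇒R w Rbc

  module _ where
    open import Data.List.Membership.DecPropositional (_≟_ {n}) using (_∈?_) renaming (_∈_ to _∈ˡ_)
    open import Data.List.Relation.Unary.Any using (here; there)
    open import Data.List.Relation.Unary.All.Properties using (¬Any⇒All¬)

    Path : Fin n → Fin n → Set
    Path a b = Σ (Walk G a b) (λ w → AllPairs _≢_ (vertices w))

    suffixFrom : ∀ {x a b} (w : Walk G a b) → x ∈ˡ vertices w → AllPairs _≢_ (vertices w) → Path x b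
    suffixFrom here         (here refl) u       = here , u
    suffixFrom (step e w)   (here refl) u       = step e w , u
    suffixFrom (step _ w)   (there x∈w) (_ ∷ u) = suffixFrom w x∈w u

    walk⇒path : ∀ {a b} → Walk G a b → Path a b
    walk⇒path here = here , [] ∷ []
    walk⇒path (step {a} e w) with walk⇒path w
    ... | w′ , u with a ∈? vertices w′
    ...   | yes a∈w′ = suffixFrom w′ a∈w′ u
    ...   | no  a∉w′ = step e w′ , ¬Any⇒All¬ (vertices w′) a∉w′ ∷ u

walk-degree : ∀ {n} {G : Graph n} {u v} → Walk G u v → u ≢ v → 1 ≤ deg G u
walk-degree here                 u≢u = ⊥-elim (u≢u refl)
walk-degree {G = G} {u} (step {w = w} e _) _ =
  subst (_≤ deg G u) (cong 𝟙 e) (term≤sumFin (λ j → 𝟙 (adj G u j)) w)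

-- Rooted trees given by parent pointers

module ParentGraph {n} (parent : Fin n → Fin n) (root : Fin n) (rank : Fin n → ℕ)
                   (descends : ∀ v → v ≢ root → rank (parent v) < rank v) where

  ChildOf : Fin n → Fin n → Set
  ChildOf a b = a ≢ root × parent a ≡ b

  nonroot : Fin n → Bool
  nonroot v = not (v ≡ᵇ root)

  childᵇ : Fin n → Fin n → Bool
  childᵇ a b = nonroot a ∧ (parent a ≡ᵇ b)

  childᵇ⇒ChildOf : ∀ {a b} → childᵇ a b ≡ true → ChildOf a b
  childᵇ⇒ChildOf {a} {b} eq with a ≟ root | parent a ≟ b
  childᵇ⇒ChildOf _  | no a≢r | yes pa≡b = a≢r , pa≡b
  childᵇ⇒ChildOf () | yes _  | _
  childᵇ⇒ChildOf () | no _   | no _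

  ChildOf⇒childᵇ : ∀ {a b} → ChildOf a b → childᵇ a b ≡ true
  ChildOf⇒childᵇ {a} {b} (a≢r , pa≡b) with a ≟ root | parent a ≟ b
  ... | no _    | yes _    = refl
  ... | yes a≡r | _        = ⊥-elim (a≢r a≡r)
  ... | no _    | no pa≢b  = ⊥-elim (pa≢b pa≡b)

  rank-< : ∀ {a b} → ChildOf a b → rank b < rank a
  rank-< {a} (a≢r , refl) = descends a a≢r

  childᵇ-irrefl : ∀ a → childᵇ a a ≡ false
  childᵇ-irrefl a with childᵇ a a in eq
  ... | true  = ⊥-elim (<-irrefl refl (rank-< (childᵇ⇒ChildOf eq)))
  ... | false = refl

  graph : Graph n
  graph = record
    { adj     = λ a b → childᵇ a b ∨ childᵇ b a
    ; adj-sym = λ a b → Bool.∨-comm (childᵇ a b) (childᵇ b a)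
    ; irrefl  = λ a → cong (λ c → c ∨ c) (childᵇ-irrefl a) }

  edge-cases : ∀ {a b} → Adj graph a b → ChildOf a b ⊎ ChildOf b a
  edge-cases {a} {b} e with childᵇ a b in ab | childᵇ b a in ba
  ... | true  | _    = inj₁ (childᵇ⇒ChildOf ab)
  ... | false | true = inj₂ (childᵇ⇒ChildOf ba)

  child-edge : ∀ {a b} → ChildOf a b → Adj graph a b
  child-edge c rewrite ChildOf⇒childᵇ c = refl

  parent-edge : ∀ {a b} → ChildOf b a → Adj graph a b
  parent-edge {a} {b} c rewrite ChildOf⇒childᵇ c = Bool.∨-zeroʳ (childᵇ a b)

  walkToRoot : ∀ v → Acc _<_ (rank v) → Walk graph v root
  walkToRoot v (acc rs) with v ≟ root
  ... | yes refl = here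
  ... | no v≢r   = step (child-edge (v≢r , refl)) (walkToRoot (parent v) (rs (descends v v≢r)))

  connected : Connected graph
  connected u v = toRoot u ++ʷ reverseʷ (toRoot v)
    where toRoot = λ w → walkToRoot w (<-wellFounded (rank w))

  descending : ∀ a ws z → Linked (Adj graph) (a ∷ ws ∷ʳ z) → NonBacktracking (a ∷ ws ∷ʳ z) →
               ChildOf (second z ws) a → rank a < rank z × ChildOf z (penultimate a ws)
  descending a []       z _ _  z-child = rank-< z-child , z-child
  descending a (b ∷ ws) z l nb b-child with edge-cases (linked-second b ws z (Linked.tail l))
  ... | inj₁ (_ , pb≡c) = ⊥-elim (nonBacktracking-second a b ws z nb (trans (sym (proj₂ b-child)) pb≡c))
  ... | inj₂ c-child    with descending b ws z (Linked.tail l) (nonBacktracking-tail a b ws z nb) c-child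
  ...   | b<z , last    = <-trans (rank-< b-child) b<z , last

  -- A non-backtracking walk only climbs until its first downward step.
  ascending-or-ends-descending : ∀ a ws z → Linked (Adj graph) (a ∷ ws ∷ʳ z) →
    NonBacktracking (a ∷ ws ∷ʳ z) → rank z < rank a ⊎ ChildOf z (penultimate a ws)
  ascending-or-ends-descending a ws z l nb with edge-cases (linked-second a ws z l)
  ... | inj₂ down = inj₂ (proj₂ (descending a ws z l nb down))
  ascending-or-ends-descending a []       z l nb | inj₁ up = inj₁ (rank-< up)
  ascending-or-ends-descending a (b ∷ ws) z l nb | inj₁ up
    with ascending-or-ends-descending b ws z (Linked.tail l) (nonBacktracking-tail a b ws z nb)
  ... | inj₁ z<b = inj₁ (<-trans z<b (rank-< up))
  ... | inj₂ last = inj₂ last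

  -- A cycle cannot leave v downwards (ranks would increase all the way back to v); leaving upwards
  -- to b = parent v, it re-enters v either from above (rank v < rank b) or from the parent b again.
  acyclic : Acyclic graph
  acyclic []                 ()
  acyclic (v ∷ [])           (_ , () , _)
  acyclic (v ∷ b ∷ [])       (_ , s≤s () , _)
  acyclic (v ∷ b ∷ c ∷ rest) (v∉ ∷ b∉ ∷ u , _ , l)
    with edge-cases (Linked.head l)
  ... | inj₂ down = <-irrefl refl (proj₁ (descending v (b ∷ c ∷ rest) v l nb down))
    where nb = All.head (All.tail v∉) , nonBacktracking-∷ʳ (b ∷ c ∷ rest) v (b∉ ∷ u) v∉
  ... | inj₁ up@(_ , pv≡b)
    with ascending-or-ends-descending b (c ∷ rest) v (Linked.tail l)
           (nonBacktracking-∷ʳ (b ∷ c ∷ rest) v (b∉ ∷ u) v∉)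
  ...   | inj₁ v<b = <-asym v<b (rank-< up)
  ...   | inj₂ (_ , pv≡last) = ≢-penultimate c rest b∉ (trans (sym pv≡b) pv≡last)

  children : Fin n → ℕ
  children v = sumFin (λ j → 𝟙 (childᵇ j v))

  parent-count : ∀ v → sumFin (λ j → 𝟙 (childᵇ v j)) ≡ 𝟙 (nonroot v)
  parent-count v with v ≟ root
  ... | yes _ = sumFin-zero n
  ... | no  _ = sumFin-point (parent v) 1

  deg-graph : ∀ v → deg graph v ≡ 𝟙 (nonroot v) + children v
  deg-graph v = begin
    deg graph v
      ≡⟨ sumFin-cong (λ j → 𝟙-∨ (childᵇ v j) (childᵇ j v) (not-both j)) ⟩
    sumFin (λ j → 𝟙 (childᵇ v j) + 𝟙 (childᵇ j v))
      ≡⟨ sumFin-distrib-+ (λ j → 𝟙 (childᵇ v j)) (λ j → 𝟙 (childᵇ j v)) ⟩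
    sumFin (λ j → 𝟙 (childᵇ v j)) + children v
      ≡⟨ cong (_+ children v) (parent-count v) ⟩
    𝟙 (nonroot v) + children v ∎
    where
    open ≡-Reasoning
    not-both : ∀ j → childᵇ v j ≡ true → childᵇ j v ≡ true → ⊥
    not-both j vj jv = <-asym (rank-< (childᵇ⇒ChildOf vj)) (rank-< (childᵇ⇒ChildOf jv))

  degree-sum : sumFin (deg graph) + 2 ≡ n + n
  degree-sum = begin
    sumFin (deg graph) + 2
      ≡⟨ cong (_+ 2) (sumFin-cong deg-graph) ⟩
    sumFin (λ v → 𝟙 (nonroot v) + children v) + 2
      ≡⟨ cong (_+ 2) (sumFin-distrib-+ (λ v → 𝟙 (nonroot v)) children) ⟩
    (N + sumFin children) + 2
      ≡⟨ cong (λ m → (N + m) + 2) children-total ⟩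
    (N + N) + 2
      ≡⟨ solve 1 (λ a → (a :+ a) :+ con 2 := (a :+ con 1) :+ (a :+ con 1)) refl N ⟩
    (N + 1) + (N + 1)
      ≡⟨ cong₂ _+_ (sumFin-≢ root) (sumFin-≢ root) ⟩
    n + n ∎
    where
    open ≡-Reasoning
    N = sumFin (λ v → 𝟙 (nonroot v))
    children-total : sumFin children ≡ N
    children-total = trans (sumFin-comm (λ v j → 𝟙 (childᵇ j v))) (sumFin-cong parent-count)

-- The degree sum of a tree

least : ∀ {P : ℕ → Set} → Decidable P → ∀ k → P k → ∃ λ m → P m × (∀ j → j < m → ¬ P j)
least P? k Pk with P? 0
... | yes P0 = 0 , P0 , λ _ ()
least P? zero    Pk | no ¬P0 = ⊥-elim (¬P0 Pk)
least P? (suc k) Pk | no ¬P0 with least (λ j → P? (suc j)) k Pk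
... | m , Pm , below = suc m , Pm , λ { zero _ → ¬P0 ; (suc j) (s≤s j<m) → below j j<m }

module TreeAsParentGraph {n} (T : Graph n) (tree : IsTree T) (root : Fin n) where

  Near : ℕ → Fin n → Set
  Near zero    v = v ≡ root
  Near (suc L) v = Near L v ⊎ ∃ λ u → Adj T v u × Near L u

  near? : ∀ L v → Dec (Near L v)
  near? zero    v = v ≟ root
  near? (suc L) v = near? L v ⊎-dec any? (λ u → (adj T v u Bool.≟ true) ×-dec near? L u)

  walk⇒near : ∀ {v} (w : Walk T v root) → Near (lengthʷ w) v
  walk⇒near here               = refl
  walk⇒near (step {w = u} e w) = inj₂ (u , e , walk⇒near w)

  nearest : ∀ v → ∃ λ m → Near m v × (∀ j → j < m → ¬ Near j v)
  nearest v = least (λ L → near? L v) _ (walk⇒near (proj₁ tree v root))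

  depth : Fin n → ℕ
  depth v = proj₁ (nearest v)

  depth-≤ : ∀ {L v} → Near L v → depth v ≤ L
  depth-≤ {L} {v} near = ≮⇒≥ (λ L<depth → proj₂ (proj₂ (nearest v)) L L<depth near)

  parent : Fin n → Fin n
  parent v with nearest v
  ... | suc _ , inj₂ (u , _) , _ = u
  ... | _                        = v

  parent-spec : ∀ v → v ≢ root → Adj T v (parent v) × depth (parent v) < depth v
  parent-spec v v≢r with nearest v
  ... | zero  , v≡r , _                = ⊥-elim (v≢r v≡r)
  ... | suc D , inj₁ near , minimal    = ⊥-elim (minimal D ≤-refl near)
  ... | suc D , inj₂ (u , vu , near) , _ = vu , s≤s (depth-≤ near)

  module P = ParentGraph parent root depth (λ v v≢r → proj₂ (parent-spec v v≢r))

  graph-edge⇒T-edge : ∀ {i j} → Adj P.graph i j → Adj T i j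
  graph-edge⇒T-edge {i} {j} e with P.edge-cases {i} {j} e
  ... | inj₁ (i≢r , pi≡j) = subst (Adj T i) pi≡j (proj₁ (parent-spec i i≢r))
  ... | inj₂ (j≢r , pj≡i) = trans (adj-sym T i j) (subst (Adj T j) pj≡i (proj₁ (parent-spec j j≢r)))

  -- An edge of T missing from the parent graph would close a cycle with the path joining its ends there.
  T-edge⇒graph-edge : ∀ {i j} → Adj T i j → Adj P.graph i j
  T-edge⇒graph-edge {i} {j} e with adj P.graph i j in eq
  ... | true  = refl
  ... | false with walk⇒path (P.connected i j)
  ...   | here , _                     = ⊥-elim (true≢false (trans (sym e) (irrefl T i)))
  ...   | step e′ here , _             = ⊥-elim (true≢false (trans (sym e′) eq))
  ...   | step e′ w@(step _ w′) , unique =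
    ⊥-elim (proj₂ tree (vertices (step e′ w))
      (unique , s≤s (nonempty w′) , linked-vertices graph-edge⇒T-edge (step e′ w) (trans (adj-sym T j i) e)))
    where
    nonempty : ∀ {a b} (w : Walk P.graph a b) → 1 ≤ length (vertices w)
    nonempty here       = s≤s z≤n
    nonempty (step _ _) = s≤s z≤n

  adj-graph : ∀ i j → adj T i j ≡ adj P.graph i j
  adj-graph i j = Bool.⇔→≡ (mk⇔ T-edge⇒graph-edge graph-edge⇒T-edge)

  degree-sum : sumFin (deg T) + 2 ≡ n + n
  degree-sum =
    trans (cong (_+ 2) (sumFin-cong (λ v → sumFin-cong (λ j → cong 𝟙 (adj-graph v j)))))
          P.degree-sum

tree-degree-sum : ∀ {n} (T : Graph (suc n)) → IsTree T → sumFin (deg T) + 2 ≡ suc n + suc n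
tree-degree-sum T tree = TreeAsParentGraph.degree-sum T tree zero

-- Matchings certify minimum vertex covers

card≡sumFin : ∀ {n} (X : Subset n) → ∣ X ∣ ≡ sumFin (λ i → 𝟙 (lookup X i))
card≡sumFin []          = refl
card≡sumFin (true ∷ X)  = cong suc (card≡sumFin X)
card≡sumFin (false ∷ X) = card≡sumFin X

∉⇒lookup≡false : ∀ {n} {i : Fin n} {X : Subset n} → i ∉ X → lookup X i ≡ false
∉⇒lookup≡false {i = i} {X} i∉X with lookup X i in eq
... | true  = ⊥-elim (i∉X (lookup⇒[]= i X eq))
... | false = refl

-- Each x ∈ X ∖ Y has its partner in Y ∖ X, and back keeps the partners of distinct x apart.
matched-cover-minimum : ∀ {n} (G : Graph n) (X : Subset n) (back : Fin n → Fin n) →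
  (∀ x → x ∈ X → ∃ λ j → Adj G x j × j ∉ X × back j ≡ x) →
  VertexCover G X → MinimumVertexCover G X
matched-cover-minimum {n} G X back matched cover = cover , minimum
  where
  minimum : ∀ Y → VertexCover G Y → ∣ X ∣ ≤ ∣ Y ∣
  minimum Y coverY = begin
    ∣ X ∣
      ≡⟨ card≡sumFin X ⟩
    sumFin (λ i → 𝟙 (x i))
      ≡⟨ sumFin-cong (λ i → when-complement (y i) (𝟙 (x i))) ⟨
    sumFin (λ i → when (y i) (𝟙 (x i)) + when (not (y i)) (𝟙 (x i)))
      ≡⟨ sumFin-distrib-+ (λ i → when (y i) (𝟙 (x i))) (λ i → when (not (y i)) (𝟙 (x i))) ⟩
    sumFin (λ i → when (y i) (𝟙 (x i))) + sumFin (λ i → when (not (y i)) (𝟙 (x i)))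
      ≤⟨ +-monoʳ-≤ (sumFin (λ i → when (y i) (𝟙 (x i)))) uncovered≤partners ⟩
    sumFin (λ i → when (y i) (𝟙 (x i))) + sumFin partner
      ≡⟨ sumFin-distrib-+ (λ i → when (y i) (𝟙 (x i))) partner ⟨
    sumFin (λ i → when (y i) (𝟙 (x i)) + partner i)
      ≡⟨ sumFin-cong (λ i → split (y i) (x i)) ⟩
    sumFin (λ i → 𝟙 (y i))
      ≡⟨ card≡sumFin Y ⟨
    ∣ Y ∣ ∎
    where
    open ≤-Reasoning
    x y : Fin n → Bool
    x = lookup X
    y = lookup Y
    partner : Fin n → ℕ
    partner j = when (y j) (𝟙 (not (x j)))
    split : ∀ b c → when b (𝟙 c) + when b (𝟙 (not c)) ≡ 𝟙 b
    split true  c = when-complement c 1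
    split false c = refl
    uncovered≤ : ∀ i → when (not (y i)) (𝟙 (x i)) ≤ sumFin (λ j → when (back j ≡ᵇ i) (partner j))
    uncovered≤ i with y i in yi | x i in xi
    ... | true  | _     = z≤n
    ... | false | false = z≤n
    ... | false | true  with matched i (lookup⇒[]= i X xi)
    ...   | j , ij , j∉X , back-j with coverY i j ij
    ...     | inj₁ i∈Y = ⊥-elim (true≢false (trans (sym ([]=⇒lookup i∈Y)) yi))
    ...     | inj₂ j∈Y = subst (_≤ sumFin (λ k → when (back k ≡ᵇ i) (partner k))) term≡1
                               (term≤sumFin (λ k → when (back k ≡ᵇ i) (partner k)) j)
      where
      term≡1 : when (back j ≡ᵇ i) (partner j) ≡ 1
      term≡1 rewrite dec-true (back j ≟ i) back-j | []=⇒lookup j∈Y | ∉⇒lookup≡false j∉X = refl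
    uncovered≤partners : sumFin (λ i → when (not (y i)) (𝟙 (x i))) ≤ sumFin partner
    uncovered≤partners = begin
      sumFin (λ i → when (not (y i)) (𝟙 (x i)))
        ≤⟨ sumFin-mono uncovered≤ ⟩
      sumFin (λ i → sumFin (λ j → when (back j ≡ᵇ i) (partner j)))
        ≡⟨ sumFin-comm (λ i j → when (back j ≡ᵇ i) (partner j)) ⟩
      sumFin (λ j → sumFin (λ i → when (back j ≡ᵇ i) (partner j)))
        ≡⟨ sumFin-cong (λ j → sumFin-point (back j) (partner j)) ⟩
      sumFin partner ∎

-- Growing the tree slot by slot

choose-preferring : ∀ {n} {Q R : Fin n → Set} → Decidable Q → Decidable R → ∃ Q →
                    ∃ λ i → Q i × (R i ⊎ ∀ j → Q j → ¬ R j)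
choose-preferring Q? R? (i , Qi) with any? (λ j → Q? j ×-dec R? j)
... | yes (j , Qj , Rj) = j , Qj , inj₁ Rj
... | no ¬QR            = i , Qi , inj₂ (λ j Qj Rj → ¬QR (j , Qj , Rj))

module _ {S : Set} {Inv Done : S → Set} (μ : S → ℕ)
         (progress : ∀ s → Inv s → Done s ⊎ Σ S (λ s′ → Inv s′ × μ s′ < μ s)) where

  iterate : ∀ s → Inv s → Σ S (λ s′ → Inv s′ × Done s′)
  iterate s = go s (<-wellFounded (μ s))
    where
    go : ∀ s → Acc _<_ (μ s) → Inv s → Σ S (λ s′ → Inv s′ × Done s′)
    go s (acc rs) inv with progress s inv
    ... | inj₁ done              = s , inv , done
    ... | inj₂ (s′ , inv′ , μ<) = go s′ (rs μ<) inv′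

module Construction {n} (d : Fin n → ℕ) (inX : Fin n → Bool) (root : Fin n)
                    (d-positive : ∀ i → 1 ≤ d i) where

  inY : Fin n → Bool
  inY i = not (inX i)

  nonroot : Fin n → Bool
  nonroot v = not (v ≡ᵇ root)

  -- The number of children v gets in the final tree: all its edges but the one to its parent.
  slots : Fin n → ℕ
  slots v = d v ∸ 𝟙 (nonroot v)

  slots-nonroot : ∀ {v} → v ≢ root → slots v ≡ d v ∸ 1
  slots-nonroot {v} v≢r = cong (λ b → d v ∸ 𝟙 (not b)) (dec-false (v ≟ root) v≢r)

  slots-root : slots root ≡ d root
  slots-root = cong (λ b → d root ∸ 𝟙 (not b)) (dec-true (root ≟ root) refl)

  slots+1 : ∀ {v} → v ≢ root → slots v + 1 ≡ d v
  slots+1 {v} v≢r = trans (cong (_+ 1) (slots-nonroot v≢r)) (m∸n+n≡m (d-positive v))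

  record State : Set where
    field
      placed : Fin n → Bool
      parent : Fin n → Fin n
      rank   : Fin n → ℕ
      free   : Fin n → ℕ
      clock  : ℕ
  open State public

  Placed Unplaced : State → Fin n → Set
  Placed   s v = placed s v ≡ true
  Unplaced s v = placed s v ≡ false

  children : State → Fin n → ℕ
  children s v = sumFin (λ j → 𝟙 (placed s j ∧ nonroot j ∧ (parent s j ≡ᵇ v)))

  Σunplaced : State → (Fin n → ℕ) → ℕ
  Σunplaced s f = sumFin (λ i → when (not (placed s i)) (f i))

  Σfree : State → (Fin n → Bool) → ℕ
  Σfree s w = sumFin (λ i → when (w i) (free s i))

  #unplaced #unplacedX #unplacedY pendingY freeAll freeX freeY : State → ℕ
  #unplaced  s = Σunplaced s (λ _ → 1)
  #unplacedX s = Σunplaced s (λ i → 𝟙 (inX i))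
  #unplacedY s = Σunplaced s (λ i → 𝟙 (inY i))
  pendingY   s = Σunplaced s (λ i → when (inY i) (d i ∸ 1))
  freeAll    s = Σfree s (λ _ → true)
  freeX      s = Σfree s inX
  freeY      s = Σfree s inY

  record Valid (s : State) : Set where
    field
      root-placed       : Placed s root
      parent-placed     : ∀ v → Placed s v → v ≢ root → Placed s (parent s v)
      parent-rank       : ∀ v → Placed s v → v ≢ root → rank s (parent s v) < rank s v
      rank<clock        : ∀ v → Placed s v → rank s v < clock s
      slots-split       : ∀ v → Placed s v → children s v + free s v ≡ slots v
      children-unplaced : ∀ v → Unplaced s v → children s v ≡ 0
      free-unplaced     : ∀ v → Unplaced s v → free s v ≡ 0
      -- Each vertex still to be placed takes one free slot and brings d − 1 new ones.
      balance           : freeAll s + Σunplaced s d ≡ #unplaced s + #unplaced s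
      covered           : ∀ v → Placed s v → v ≢ root → inX v ≡ true ⊎ inX (parent s v) ≡ true
  open Valid public

  MatchedVia : State → Fin n → Fin n → Set
  MatchedVia s x j = Placed s j × j ≢ root × parent s j ≡ x × inX j ≡ false

  Matched : State → Set
  Matched s = ∀ x → Placed s x → inX x ≡ true → ∃ (MatchedVia s x)

  attach : State → Fin n → Fin n → State
  attach s v u = record
    { placed = updateAt (placed s) v (const true)
    ; parent = updateAt (parent s) v (const u)
    ; rank   = updateAt (rank s) v (const (clock s))
    ; free   = updateAt (updateAt (free s) u (_∸ 1)) v (const (slots v))
    ; clock  = suc (clock s)
    }

  module Attach {s : State} (valid : Valid s) {v u : Fin n}
                (v-unplaced : Unplaced s v) (u-placed : Placed s u) where

    s′ : State
    s′ = attach s v u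

    placed≢ : ∀ {a b} → Placed s a → Unplaced s b → a ≢ b
    placed≢ a-placed b-unplaced refl = true≢false (trans (sym a-placed) b-unplaced)

    u≢v : u ≢ v
    u≢v = placed≢ u-placed v-unplaced

    v≢root : v ≢ root
    v≢root = ≢-sym (placed≢ (root-placed valid) v-unplaced)

    placed-v : Placed s′ v
    placed-v = updateAt-updates v (placed s)

    placed-≢ : ∀ {i} → i ≢ v → placed s′ i ≡ placed s i
    placed-≢ {i} i≢v = updateAt-minimal i v (placed s) i≢v

    parent-≢ : ∀ {i} → i ≢ v → parent s′ i ≡ parent s i
    parent-≢ {i} i≢v = updateAt-minimal i v (parent s) i≢v

    rank-≢ : ∀ {i} → i ≢ v → rank s′ i ≡ rank s i
    rank-≢ {i} i≢v = updateAt-minimal i v (rank s) i≢v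

    free-v : free s′ v ≡ slots v
    free-v = updateAt-updates v (updateAt (free s) u (_∸ 1))

    free-u : free s′ u ≡ free s u ∸ 1
    free-u = trans (updateAt-minimal u v _ u≢v) (updateAt-updates u (free s))

    free-≢ : ∀ {i} → i ≢ v → i ≢ u → free s′ i ≡ free s i
    free-≢ {i} i≢v i≢u = trans (updateAt-minimal i v _ i≢v) (updateAt-minimal i u (free s) i≢u)

    keeps-placed : ∀ {i} → Placed s i → Placed s′ i
    keeps-placed i-placed = trans (placed-≢ (placed≢ i-placed v-unplaced)) i-placed

    placed-cases : ∀ {i} → Placed s′ i → i ≡ v ⊎ (i ≢ v × Placed s i)
    placed-cases {i} i-placed with i ≟ v
    ... | yes i≡v = inj₁ i≡v
    ... | no  i≢v = inj₂ (i≢v , trans (sym (placed-≢ i≢v)) i-placed)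

    unplaced-before : ∀ {i} → Unplaced s′ i → Unplaced s i × i ≢ v × i ≢ u
    unplaced-before {i} i-unplaced with i ≟ v
    ... | yes refl = ⊥-elim (true≢false (trans (sym placed-v) i-unplaced))
    ... | no  i≢v  = i-unplaced-s , i≢v , ≢-sym (placed≢ u-placed i-unplaced-s)
      where i-unplaced-s = trans (sym (placed-≢ i≢v)) i-unplaced

    keeps-matched : ∀ {x j} → MatchedVia s x j → MatchedVia s′ x j
    keeps-matched (j-placed , j≢r , pj≡x , j∉X) =
      keeps-placed j-placed , j≢r , trans (parent-≢ (placed≢ j-placed v-unplaced)) pj≡x , j∉X

    Σunplaced-attach : ∀ f → Σunplaced s′ f + f v ≡ Σunplaced s f
    Σunplaced-attach f = begin
      Σunplaced s′ f + f v
        ≡⟨ cong (λ b → Σunplaced s′ f + when (not b) (f v)) v-unplaced ⟨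
      Σunplaced s′ f + when (not (placed s v)) (f v)
        ≡⟨ sumFin-agree-except (λ i → when (not (placed s i)) (f i)) (λ i → when (not (placed s′ i)) (f i)) v
             (λ i i≢v → cong (λ b → when (not b) (f i)) (sym (placed-≢ i≢v))) ⟩
      Σunplaced s f + when (not (placed s′ v)) (f v)
        ≡⟨ cong (λ b → Σunplaced s f + when (not b) (f v)) placed-v ⟩
      Σunplaced s f + 0
        ≡⟨ +-identityʳ _ ⟩
      Σunplaced s f ∎
      where open ≡-Reasoning

    parent-v : parent s′ v ≡ u
    parent-v = updateAt-updates v (parent s)

    rank-v : rank s′ v ≡ clock s
    rank-v = updateAt-updates v (rank s)

    children-attach : ∀ x → children s′ x ≡ children s x + 𝟙 (u ≡ᵇ x)
    children-attach x = begin
      children s′ x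
        ≡⟨ +-identityʳ (children s′ x) ⟨
      children s′ x + 0
        ≡⟨ cong (λ b → children s′ x + 𝟙 (b ∧ nonroot v ∧ (parent s v ≡ᵇ x))) v-unplaced ⟨
      children s′ x + term s v
        ≡⟨ sumFin-agree-except (term s) (term s′) v
             (λ i i≢v → cong₂ (λ b p → 𝟙 (b ∧ nonroot i ∧ (p ≡ᵇ x))) (sym (placed-≢ i≢v)) (sym (parent-≢ i≢v))) ⟩
      children s x + term s′ v
        ≡⟨ cong (children s x +_) new-child ⟩
      children s x + 𝟙 (u ≡ᵇ x) ∎
      where
      open ≡-Reasoning
      term : State → Fin n → ℕ
      term t j = 𝟙 (placed t j ∧ nonroot j ∧ (parent t j ≡ᵇ x))
      new-child : term s′ v ≡ 𝟙 (u ≡ᵇ x)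
      new-child rewrite placed-v | parent-v | dec-false (v ≟ root) v≢root = refl

    children-≢ : ∀ {x} → x ≢ u → children s′ x ≡ children s x
    children-≢ {x} x≢u =
      trans (children-attach x) (trans (cong (λ b → children s x + 𝟙 b) (dec-false (u ≟ x) (≢-sym x≢u)))
                                       (+-identityʳ _))

    #unplaced-attach : #unplaced s′ + 1 ≡ #unplaced s
    #unplaced-attach = Σunplaced-attach (λ _ → 1)

    module _ (v∈Y : inX v ≡ false) where

      #unplacedX-attach-Y : #unplacedX s′ ≡ #unplacedX s
      #unplacedX-attach-Y = trans (sym (+-identityʳ _))
        (trans (cong (λ b → #unplacedX s′ + 𝟙 b) (sym v∈Y)) (Σunplaced-attach (λ i → 𝟙 (inX i))))

      #unplacedY-attach-Y : #unplacedY s′ + 1 ≡ #unplacedY s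
      #unplacedY-attach-Y =
        trans (cong (λ b → #unplacedY s′ + 𝟙 (not b)) (sym v∈Y)) (Σunplaced-attach (λ i → 𝟙 (inY i)))

      pendingY-attach-Y : pendingY s′ + (d v ∸ 1) ≡ pendingY s
      pendingY-attach-Y = trans (cong (λ b → pendingY s′ + when (not b) (d v ∸ 1)) (sym v∈Y))
                                (Σunplaced-attach (λ i → when (inY i) (d i ∸ 1)))

    module _ (v∈X : inX v ≡ true) where

      #unplacedX-attach-X : #unplacedX s′ + 1 ≡ #unplacedX s
      #unplacedX-attach-X =
        trans (cong (λ b → #unplacedX s′ + 𝟙 b) (sym v∈X)) (Σunplaced-attach (λ i → 𝟙 (inX i)))

      #unplacedY-attach-X : #unplacedY s′ ≡ #unplacedY s
      #unplacedY-attach-X = trans (sym (+-identityʳ _))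
        (trans (cong (λ b → #unplacedY s′ + 𝟙 (not b)) (sym v∈X)) (Σunplaced-attach (λ i → 𝟙 (inY i))))

      pendingY-attach-X : pendingY s′ ≡ pendingY s
      pendingY-attach-X = trans (sym (+-identityʳ _))
        (trans (cong (λ b → pendingY s′ + when (not b) (d v ∸ 1)) (sym v∈X))
               (Σunplaced-attach (λ i → when (inY i) (d i ∸ 1))))

    module _ (u-free : 1 ≤ free s u) where

      Σfree-attach : ∀ w → Σfree s′ w + 𝟙 (w u) ≡ Σfree s w + when (w v) (slots v)
      Σfree-attach w = begin
        Σfree s′ w + 𝟙 (w u)
          ≡⟨ cong (_+ 𝟙 (w u)) (+-identityʳ (Σfree s′ w)) ⟨
        Σfree s′ w + 0 + 𝟙 (w u)
          ≡⟨ cong (λ m → Σfree s′ w + m + 𝟙 (w u)) free₁-v ⟨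
        Σfree s′ w + when (w v) (free₁ v) + 𝟙 (w u)
          ≡⟨ cong (_+ 𝟙 (w u)) (sumFin-agree-except (weighted free₁) (weighted (free s′)) v
               (λ i i≢v → cong (when (w i)) (sym (updateAt-minimal i v free₁ i≢v)))) ⟩
        sumFin (weighted free₁) + when (w v) (free s′ v) + 𝟙 (w u)
          ≡⟨ solve 3 (λ a b c → a :+ b :+ c := a :+ c :+ b) refl
               (sumFin (weighted free₁)) (when (w v) (free s′ v)) (𝟙 (w u)) ⟩
        sumFin (weighted free₁) + 𝟙 (w u) + when (w v) (free s′ v)
          ≡⟨ cong₂ _+_ decrement-u (cong (when (w v)) free-v) ⟩
        Σfree s w + when (w v) (slots v) ∎
        where
        open ≡-Reasoning
        free₁ : Fin n → ℕ
        free₁ = updateAt (free s) u (_∸ 1)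
        weighted : (Fin n → ℕ) → Fin n → ℕ
        weighted f i = when (w i) (f i)
        free₁-v : when (w v) (free₁ v) ≡ 0
        free₁-v = trans (cong (when (w v)) (trans (updateAt-minimal v u (free s) (≢-sym u≢v))
                                                  (free-unplaced valid v v-unplaced)))
                        (when-zero (w v))
        decrement-u : sumFin (weighted free₁) + 𝟙 (w u) ≡ Σfree s w
        decrement-u = +-cancelʳ-≡ (when (w u) (free s u ∸ 1)) _ _ (begin
          sumFin (weighted free₁) + 𝟙 (w u) + when (w u) (free s u ∸ 1)
            ≡⟨ +-assoc (sumFin (weighted free₁)) _ _ ⟩
          sumFin (weighted free₁) + (𝟙 (w u) + when (w u) (free s u ∸ 1))
            ≡⟨ cong (sumFin (weighted free₁) +_) (trans (+-comm (𝟙 (w u)) _) (sym (when-suc (w u) _))) ⟩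
          sumFin (weighted free₁) + when (w u) (suc (free s u ∸ 1))
            ≡⟨ cong (λ m → sumFin (weighted free₁) + when (w u) m)
                    (trans (+-comm 1 (free s u ∸ 1)) (m∸n+n≡m u-free)) ⟩
          sumFin (weighted free₁) + weighted (free s) u
            ≡⟨ sumFin-agree-except (weighted (free s)) (weighted free₁) u
                 (λ i i≢u → cong (when (w i)) (sym (updateAt-minimal i u (free s) i≢u))) ⟩
          Σfree s w + weighted free₁ u
            ≡⟨ cong (λ m → Σfree s w + when (w u) m) (updateAt-updates u (free s)) ⟩
          Σfree s w + when (w u) (free s u ∸ 1) ∎)

      valid-attach : inX v ≡ true ⊎ inX u ≡ true → Valid s′
      valid-attach cover = record
        { root-placed       = keeps-placed (root-placed valid)
        ; parent-placed     = parent-placed′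
        ; parent-rank       = parent-rank′
        ; rank<clock        = rank<clock′
        ; slots-split       = slots-split′
        ; children-unplaced = children-unplaced′
        ; free-unplaced     = free-unplaced′
        ; balance           = balance′
        ; covered           = covered′
        }
        where
        parent-placed′ : ∀ i → Placed s′ i → i ≢ root → Placed s′ (parent s′ i)
        parent-placed′ i i-placed i≢r with placed-cases i-placed
        ... | inj₁ refl = subst (Placed s′) (sym parent-v) (keeps-placed u-placed)
        ... | inj₂ (i≢v , i-placed-s) =
          subst (Placed s′) (sym (parent-≢ i≢v)) (keeps-placed (parent-placed valid i i-placed-s i≢r))

        parent-rank′ : ∀ i → Placed s′ i → i ≢ root → rank s′ (parent s′ i) < rank s′ i
        parent-rank′ i i-placed i≢r with placed-cases i-placed
        ... | inj₁ refl = subst₂ _<_ (sym (trans (cong (rank s′) parent-v) (rank-≢ u≢v))) (sym rank-v)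
                                 (rank<clock valid u u-placed)
        ... | inj₂ (i≢v , i-placed-s) =
          subst₂ _<_ (sym (trans (cong (rank s′) (parent-≢ i≢v)) (rank-≢ (placed≢ p-placed v-unplaced))))
                     (sym (rank-≢ i≢v)) (parent-rank valid i i-placed-s i≢r)
          where p-placed = parent-placed valid i i-placed-s i≢r

        rank<clock′ : ∀ i → Placed s′ i → rank s′ i < clock s′
        rank<clock′ i i-placed with placed-cases i-placed
        ... | inj₁ refl = subst (_< suc (clock s)) (sym rank-v) (n<1+n (clock s))
        ... | inj₂ (i≢v , i-placed-s) =
          subst (_< suc (clock s)) (sym (rank-≢ i≢v)) (m<n⇒m<1+n (rank<clock valid i i-placed-s))

        slots-split′ : ∀ i → Placed s′ i → children s′ i + free s′ i ≡ slots i
        slots-split′ i i-placed with placed-cases i-placed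
        ... | inj₁ refl = begin
          children s′ v + free s′ v
            ≡⟨ cong₂ _+_ (children-≢ (≢-sym u≢v)) free-v ⟩
          children s v + slots v
            ≡⟨ cong (_+ slots v) (children-unplaced valid v v-unplaced) ⟩
          slots v ∎
          where open ≡-Reasoning
        ... | inj₂ (i≢v , i-placed-s) with i ≟ u
        ...   | yes refl = begin
          children s′ u + free s′ u
            ≡⟨ cong₂ _+_ (children-attach u) free-u ⟩
          children s u + 𝟙 (u ≡ᵇ u) + (free s u ∸ 1)
            ≡⟨ cong (λ b → children s u + 𝟙 b + (free s u ∸ 1)) (dec-true (u ≟ u) refl) ⟩
          children s u + 1 + (free s u ∸ 1)
            ≡⟨ +-assoc (children s u) 1 _ ⟩
          children s u + suc (free s u ∸ 1)
            ≡⟨ cong (children s u +_) (trans (+-comm 1 (free s u ∸ 1)) (m∸n+n≡m u-free)) ⟩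
          children s u + free s u
            ≡⟨ slots-split valid u u-placed ⟩
          slots u ∎
          where open ≡-Reasoning
        ...   | no i≢u =
          trans (cong₂ _+_ (children-≢ i≢u) (free-≢ i≢v i≢u)) (slots-split valid i i-placed-s)

        children-unplaced′ : ∀ i → Unplaced s′ i → children s′ i ≡ 0
        children-unplaced′ i i-unplaced with unplaced-before i-unplaced
        ... | i-unplaced-s , _ , i≢u = trans (children-≢ i≢u) (children-unplaced valid i i-unplaced-s)

        free-unplaced′ : ∀ i → Unplaced s′ i → free s′ i ≡ 0
        free-unplaced′ i i-unplaced with unplaced-before i-unplaced
        ... | i-unplaced-s , i≢v , i≢u = trans (free-≢ i≢v i≢u) (free-unplaced valid i i-unplaced-s)

        balance′ : freeAll s′ + Σunplaced s′ d ≡ #unplaced s′ + #unplaced s′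
        balance′ = +-cancelʳ-≡ (d v + 1) _ _ (begin
          freeAll s′ + Σunplaced s′ d + (d v + 1)
            ≡⟨ solve 4 (λ a b c e → a :+ b :+ (c :+ e) := (a :+ e) :+ (b :+ c)) refl
                 (freeAll s′) (Σunplaced s′ d) (d v) 1 ⟩
          (freeAll s′ + 1) + (Σunplaced s′ d + d v)
            ≡⟨ cong₂ _+_ (Σfree-attach (λ _ → true)) (Σunplaced-attach d) ⟩
          (freeAll s + slots v) + Σunplaced s d
            ≡⟨ solve 3 (λ a b c → a :+ b :+ c := a :+ c :+ b) refl (freeAll s) (slots v) (Σunplaced s d) ⟩
          freeAll s + Σunplaced s d + slots v
            ≡⟨ cong (_+ slots v) (balance valid) ⟩
          #unplaced s + #unplaced s + slots v
            ≡⟨ cong (λ m → m + m + slots v) (Σunplaced-attach (λ _ → 1)) ⟨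
          (#unplaced s′ + 1) + (#unplaced s′ + 1) + slots v
            ≡⟨ solve 2 (λ a b → (a :+ con 1) :+ (a :+ con 1) :+ b := a :+ a :+ (b :+ con 1 :+ con 1)) refl
                 (#unplaced s′) (slots v) ⟩
          #unplaced s′ + #unplaced s′ + (slots v + 1 + 1)
            ≡⟨ cong (λ m → #unplaced s′ + #unplaced s′ + (m + 1)) (slots+1 v≢root) ⟩
          #unplaced s′ + #unplaced s′ + (d v + 1) ∎)
          where open ≡-Reasoning

        covered′ : ∀ i → Placed s′ i → i ≢ root → inX i ≡ true ⊎ inX (parent s′ i) ≡ true
        covered′ i i-placed i≢r with placed-cases i-placed
        ... | inj₁ refl = subst (λ p → inX v ≡ true ⊎ inX p ≡ true) (sym parent-v) cover
        ... | inj₂ (i≢v , i-placed-s) =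
          subst (λ p → inX i ≡ true ⊎ inX p ≡ true) (sym (parent-≢ i≢v)) (covered valid i i-placed-s i≢r)

  Σunplaced-positive : ∀ s f → 1 ≤ Σunplaced s f → ∃ λ i → Unplaced s i × 1 ≤ f i
  Σunplaced-positive s f pos with sumFin-positive (λ i → when (not (placed s i)) (f i)) pos
  ... | i , 1≤term with placed s i in eq
  ...   | false = i , eq , 1≤term
  ...   | true  = ⊥-elim (1+n≰n 1≤term)

  Σunplaced≡0 : ∀ s f → Σunplaced s f ≡ 0 → ∀ {i} → Unplaced s i → f i ≡ 0
  Σunplaced≡0 s f Σ≡0 {i} i-unplaced =
    trans (cong (λ b → when (not b) (f i)) (sym i-unplaced))
          (sumFin≡0 (λ i → when (not (placed s i)) (f i)) Σ≡0 i)

  Σunplaced-mono : ∀ s {f g} → (∀ {i} → Unplaced s i → f i ≤ g i) → Σunplaced s f ≤ Σunplaced s g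
  Σunplaced-mono s {f} {g} f≤g = sumFin-mono pointwise
    where
    pointwise : ∀ i → when (not (placed s i)) (f i) ≤ when (not (placed s i)) (g i)
    pointwise i with placed s i in eq
    ... | true  = z≤n
    ... | false = f≤g eq

  Σunplaced-distrib-+ : ∀ s f g → Σunplaced s (λ i → f i + g i) ≡ Σunplaced s f + Σunplaced s g
  Σunplaced-distrib-+ s f g =
    trans (sumFin-cong (λ i → when-distrib-+ (not (placed s i)) (f i) (g i)))
          (sumFin-distrib-+ (λ i → when (not (placed s i)) (f i)) (λ i → when (not (placed s i)) (g i)))

  Σunplaced-cong : ∀ s {f g} → (∀ {i} → Unplaced s i → f i ≡ g i) → Σunplaced s f ≡ Σunplaced s g
  Σunplaced-cong s f≡g = ≤-antisym (Σunplaced-mono s (λ u → ≤-reflexive (f≡g u)))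
                                   (Σunplaced-mono s (λ u → ≤-reflexive (sym (f≡g u))))

  unplaced-with : ∀ s (b : Fin n → Bool) → 1 ≤ Σunplaced s (λ i → 𝟙 (b i)) →
                  ∃ λ i → Unplaced s i × b i ≡ true
  unplaced-with s b pos with Σunplaced-positive s (λ i → 𝟙 (b i)) pos
  ... | i , i-unplaced , 1≤𝟙 = i , i-unplaced , proj₁ (when-positive 1≤𝟙)

  Σfree-positive : ∀ {s} → Valid s → ∀ w → 1 ≤ Σfree s w →
                   ∃ λ i → Placed s i × w i ≡ true × 1 ≤ free s i
  Σfree-positive {s} valid w pos with sumFin-positive (λ i → when (w i) (free s i)) pos
  ... | i , 1≤term with w i in wi | placed s i in eq
  ...   | false | _     = ⊥-elim (1+n≰n 1≤term)
  ...   | true  | true  = i , eq , wi , 1≤term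
  ...   | true  | false = ⊥-elim (1+n≰n (subst (1 ≤_) (free-unplaced valid i eq) 1≤term))

  freeAll-split : ∀ s → freeAll s ≡ freeX s + freeY s
  freeAll-split s = sym (sumFin-when-split inX (free s))

  initial : State
  initial = record
    { placed = λ i → i ≡ᵇ root
    ; parent = λ i → i
    ; rank   = λ _ → 0
    ; free   = λ i → when (i ≡ᵇ root) (d i)
    ; clock  = 1
    }

  placed-initial : ∀ {v} → Placed initial v → v ≡ root
  placed-initial {v} v-placed with v ≟ root
  placed-initial _  | yes v≡r = v≡r
  placed-initial () | no  _

  free-initial-root : free initial root ≡ d root
  free-initial-root = cong (λ b → when b (d root)) (dec-true (root ≟ root) refl)

  Σunplaced-initial : ∀ f → Σunplaced initial f + f root ≡ sumFin f
  Σunplaced-initial f =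
    trans (sumFin-agree-except f (λ i → when (not (i ≡ᵇ root)) (f i)) root
             (λ i i≢r → cong (λ b → when (not b) (f i)) (sym (dec-false (i ≟ root) i≢r))))
          (trans (cong (λ b → sumFin f + when (not b) (f root)) (dec-true (root ≟ root) refl))
                 (+-identityʳ (sumFin f)))

  module _ (degree-sum : sumFin d + 2 ≡ n + n) where

    valid-initial : Valid initial
    valid-initial = record
      { root-placed       = dec-true (root ≟ root) refl
      ; parent-placed     = λ v v-placed v≢r → ⊥-elim (v≢r (placed-initial v-placed))
      ; parent-rank       = λ v v-placed v≢r → ⊥-elim (v≢r (placed-initial v-placed))
      ; rank<clock        = λ _ _ → s≤s z≤n
      ; slots-split       = slots-split₀
      ; children-unplaced = λ v _ → no-children v
      ; free-unplaced     = λ v v-unplaced → cong (λ b → when b (d v)) v-unplaced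
      ; balance           = balance₀
      ; covered           = λ v v-placed v≢r → ⊥-elim (v≢r (placed-initial v-placed))
      }
      where
      no-children : ∀ v → children initial v ≡ 0
      no-children v = trans (sumFin-cong (λ j → not-both (j ≡ᵇ root) (j ≡ᵇ v))) (sumFin-zero n)
        where
        not-both : ∀ b c → 𝟙 (b ∧ not b ∧ c) ≡ 0
        not-both true  c = refl
        not-both false c = refl

      slots-split₀ : ∀ v → Placed initial v → children initial v + free initial v ≡ slots v
      slots-split₀ v v-placed with placed-initial {v} v-placed
      ... | refl = trans (cong₂ _+_ (no-children root) free-initial-root) (sym slots-root)

      balance₀ : freeAll initial + Σunplaced initial d ≡ #unplaced initial + #unplaced initial
      balance₀ = +-cancelʳ-≡ 2 _ _ (begin
        freeAll initial + Σunplaced initial d + 2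
          ≡⟨ cong (_+ 2) (sumFin-when-split (λ i → i ≡ᵇ root) d) ⟩
        sumFin d + 2
          ≡⟨ degree-sum ⟩
        n + n
          ≡⟨ cong₂ _+_ (sumFin-≢ root) (sumFin-≢ root) ⟨
        (#unplaced initial + 1) + (#unplaced initial + 1)
          ≡⟨ solve 1 (λ a → (a :+ con 1) :+ (a :+ con 1) := a :+ a :+ con 2) refl (#unplaced initial) ⟩
        #unplaced initial + #unplaced initial + 2 ∎)
        where open ≡-Reasoning

  no-pendingY : ∀ s → (∀ j → Unplaced s j × inX j ≡ false → ¬ 2 ≤ d j) → pendingY s ≡ 0
  no-pendingY s small = n≤0⇒n≡0 (begin
    pendingY s                  ≤⟨ Σunplaced-mono s pointwise ⟩
    Σunplaced s (λ _ → 0)       ≡⟨ sumFin-cong (λ i → when-zero (not (placed s i))) ⟩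
    sumFin {n} (λ _ → 0)        ≡⟨ sumFin-zero n ⟩
    0                           ∎)
    where
    open ≤-Reasoning
    pointwise : ∀ {j} → Unplaced s j → when (inY j) (d j ∸ 1) ≤ 0
    pointwise {j} j-unplaced with inX j in eq
    ... | true  = z≤n
    ... | false = ≤-reflexive (m≤n⇒m∸n≡0 (≤-pred (≰⇒> (small j (j-unplaced , eq)))))

  -- The hypothesis says that every unplaced vertex is an X-vertex of degree at most 2 or a Y-leaf.
  Y≤freeAll : ∀ {s} → Valid s → (∀ {i} → Unplaced s i → d i + 𝟙 (inY i) ≤ 2) →
              #unplacedY s ≤ freeAll s
  Y≤freeAll {s} valid small = +-cancelˡ-≤ (Σunplaced s d) _ _ (begin
    Σunplaced s d + #unplacedY s
      ≡⟨ Σunplaced-distrib-+ s d (λ i → 𝟙 (inY i)) ⟨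
    Σunplaced s (λ i → d i + 𝟙 (inY i))
      ≤⟨ Σunplaced-mono s small ⟩
    Σunplaced s (λ _ → 1 + 1)
      ≡⟨ Σunplaced-distrib-+ s (λ _ → 1) (λ _ → 1) ⟩
    #unplaced s + #unplaced s
      ≡⟨ balance valid ⟨
    freeAll s + Σunplaced s d
      ≡⟨ +-comm (freeAll s) _ ⟩
    Σunplaced s d + freeAll s ∎)
    where open ≤-Reasoning

  Realisation : Set
  Realisation = Σ (Graph n) λ T → IsTree T × (∀ i → deg T i ≡ d i) ×
                (∀ i j → Adj T i j → inX i ≡ true ⊎ inX j ≡ true) ×
                ∃ λ (back : Fin n → Fin n) →
                  ∀ x → inX x ≡ true → ∃ λ j → Adj T x j × inX j ≡ false × back j ≡ x

  Completed : Set
  Completed = Σ State λ s → Valid s × Matched s × ∀ i → Placed s i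

  completed⇒realisation : Completed → Realisation
  completed⇒realisation (s , valid , matched , all-placed) =
    P.graph , (P.connected , P.acyclic) , degree , cover , parent s , matching
    where
    module P = ParentGraph (parent s) root (rank s) (λ v v≢r → parent-rank valid v (all-placed v) v≢r)

    nothing-unplaced : ∀ f → Σunplaced s f ≡ 0
    nothing-unplaced f = trans (sumFin-cong (λ i → cong (λ b → when (not b) (f i)) (all-placed i))) (sumFin-zero n)

    no-free : ∀ i → free s i ≡ 0
    no-free = sumFin≡0 (free s) (m+n≡0⇒m≡0 (freeAll s)
      (trans (balance valid) (cong (λ m → m + m) (nothing-unplaced (λ _ → 1)))))

    degree : ∀ v → deg P.graph v ≡ d v
    degree v = begin
      deg P.graph v                  ≡⟨ P.deg-graph v ⟩
      𝟙 (nonroot v) + P.children v   ≡⟨ cong (𝟙 (nonroot v) +_) children≡slots ⟩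
      𝟙 (nonroot v) + slots v        ≡⟨ m+[n∸m]≡n (≤-trans (when-≤ (nonroot v) 1) (d-positive v)) ⟩
      d v                            ∎
      where
      open ≡-Reasoning
      children≡slots : P.children v ≡ slots v
      children≡slots = begin
        P.children v             ≡⟨ sumFin-cong (λ j → cong (λ b → 𝟙 (b ∧ P.childᵇ j v)) (all-placed j)) ⟨
        children s v             ≡⟨ +-identityʳ _ ⟨
        children s v + 0         ≡⟨ cong (children s v +_) (no-free v) ⟨
        children s v + free s v  ≡⟨ slots-split valid v (all-placed v) ⟩
        slots v                  ∎

    cover : ∀ i j → Adj P.graph i j → inX i ≡ true ⊎ inX j ≡ true
    cover i j e with P.edge-cases {i} {j} e
    ... | inj₁ (i≢r , pi≡j) =
      subst (λ p → inX i ≡ true ⊎ inX p ≡ true) pi≡j (covered valid i (all-placed i) i≢r)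
    ... | inj₂ (j≢r , pj≡i) =
      Sum.swap (subst (λ p → inX j ≡ true ⊎ inX p ≡ true) pj≡i (covered valid j (all-placed j) j≢r))

    matching : ∀ x → inX x ≡ true → ∃ λ j → Adj P.graph x j × inX j ≡ false × parent s j ≡ x
    matching x x∈X with matched x (all-placed x) x∈X
    ... | j , (_ , j≢r , pj≡x , j∈Y) = j , P.parent-edge (j≢r , pj≡x) , j∈Y , pj≡x

  module Phases (degree-sum : sumFin d + 2 ≡ n + n)
                (X-degree   : ∀ i → inX i ≡ true → 2 ≤ d i)
                (root∈X     : inX root ≡ true)
                (X≤Y        : sumFin (λ i → 𝟙 (inX i)) ≤ sumFin (λ i → 𝟙 (inY i)))
                (Y≤X-degree : sumFin (λ i → when (inY i) (d i)) ≤ sumFin (λ i → when (inX i) (d i)))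
                where

    record Growing (s : State) : Set where
      field
        valid          : Valid s
        matched        : Matched s
        fewer-X        : #unplacedX s ≤ #unplacedY s
        -- Each free or future slot at a Y-vertex needs its own X-vertex still to be placed.
        Y-demand       : freeY s + pendingY s ≤ #unplacedX s
        pending⇒freeY  : 1 ≤ pendingY s → 1 ≤ freeY s
        X-left⇒free    : 1 ≤ #unplacedX s → 1 ≤ freeAll s

    Y-excess : sumFin (λ i → when (inY i) (d i ∸ 1)) + 1 ≤ sumFin (λ i → 𝟙 (inX i))
    Y-excess = +-cancelʳ-≤ kY _ _ (begin
      PY + 1 + kY  ≡⟨ solve 2 (λ a b → a :+ con 1 :+ b := a :+ b :+ con 1) refl PY kY ⟩
      PY + kY + 1  ≡⟨ cong (_+ 1) (trans (sym (sumFin-distrib-+ (λ i → when (inY i) (d i ∸ 1)) (λ i → 𝟙 (inY i)))) (sumFin-cong leaves)) ⟩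
      SY + 1       ≤⟨ half (begin
        SY + 1 + (SY + 1) ≡⟨ solve 1 (λ a → a :+ con 1 :+ (a :+ con 1) := a :+ a :+ con 2) refl SY ⟩
        SY + SY + 2       ≤⟨ +-monoˡ-≤ 2 (+-monoˡ-≤ SY Y≤X-degree) ⟩
        SX + SY + 2       ≡⟨ cong (_+ 2) (sumFin-when-split inX d) ⟩
        sumFin d + 2      ≡⟨ degree-sum ⟩
        n + n             ∎) ⟩
      n            ≡⟨ trans (sumFin-when-split inX (λ _ → 1)) (sumFin-one n) ⟨
      kX + kY      ∎)
      where
      open ≤-Reasoning
      PY = sumFin (λ i → when (inY i) (d i ∸ 1))
      SX = sumFin (λ i → when (inX i) (d i))
      SY = sumFin (λ i → when (inY i) (d i))
      kX = sumFin (λ i → 𝟙 (inX i))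
      kY = sumFin (λ i → 𝟙 (inY i))
      leaves : ∀ i → when (inY i) (d i ∸ 1) + 𝟙 (inY i) ≡ when (inY i) (d i)
      leaves i with inY i
      ... | true  = m∸n+n≡m (d-positive i)
      ... | false = refl
      half : ∀ {a b} → a + a ≤ b + b → a ≤ b
      half {a} {b} a+a≤b+b = ≮⇒≥ (λ b<a → <⇒≱ (+-mono-< b<a b<a) a+a≤b+b)

    valid₀ : Valid initial
    valid₀ = valid-initial degree-sum

    1≤#X : 1 ≤ sumFin (λ i → 𝟙 (inX i))
    1≤#X = subst (_≤ sumFin (λ i → 𝟙 (inX i))) (cong 𝟙 root∈X) (term≤sumFin (λ i → 𝟙 (inX i)) root)

    #unplacedX-initial : #unplacedX initial + 1 ≡ sumFin (λ i → 𝟙 (inX i))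
    #unplacedX-initial =
      trans (cong (λ b → #unplacedX initial + 𝟙 b) (sym root∈X)) (Σunplaced-initial (λ i → 𝟙 (inX i)))

    #unplacedY-initial : #unplacedY initial ≡ sumFin (λ i → 𝟙 (inY i))
    #unplacedY-initial = trans (sym (+-identityʳ _))
      (trans (cong (λ b → #unplacedY initial + 𝟙 (not b)) (sym root∈X)) (Σunplaced-initial (λ i → 𝟙 (inY i))))

    pendingY-initial : pendingY initial ≡ sumFin (λ i → when (inY i) (d i ∸ 1))
    pendingY-initial = trans (sym (+-identityʳ _))
      (trans (cong (λ b → pendingY initial + when (not b) (d root ∸ 1)) (sym root∈X))
             (Σunplaced-initial (λ i → when (inY i) (d i ∸ 1))))

    freeY-initial : freeY initial ≡ 0
    freeY-initial = trans (sumFin-cong only-root) (sumFin-zero n)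
      where
      only-root : ∀ i → when (inY i) (free initial i) ≡ 0
      only-root i with i ≟ root
      ... | yes refl = cong (λ b → when (not b) (d root)) root∈X
      ... | no  _    = when-zero (inY i)

    module Start {y} (y-unplaced : Unplaced initial y) (y∈Y : inX y ≡ false)
                 (y-choice : 2 ≤ d y ⊎ ∀ j → Unplaced initial j × inX j ≡ false → ¬ 2 ≤ d j) where

      root-free : 1 ≤ free initial root
      root-free = subst (1 ≤_) (sym free-initial-root) (≤-trans (s≤s z≤n) (X-degree root root∈X))

      open Attach valid₀ {y} {root} y-unplaced (root-placed valid₀)

      freeY₁ : freeY s′ ≡ d y ∸ 1
      freeY₁ = begin
        freeY s′                              ≡⟨ +-identityʳ _ ⟨
        freeY s′ + 0                          ≡⟨ cong (λ b → freeY s′ + 𝟙 (not b)) root∈X ⟨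
        freeY s′ + 𝟙 (inY root)               ≡⟨ Σfree-attach root-free inY ⟩
        freeY initial + when (inY y) (slots y) ≡⟨ cong₂ (λ m b → m + when (not b) (slots y)) freeY-initial y∈Y ⟩
        slots y                               ≡⟨ slots-nonroot v≢root ⟩
        d y ∸ 1                               ∎
        where open ≡-Reasoning

      growing : Growing s′
      growing = record
        { valid         = valid-attach root-free (inj₂ root∈X)
        ; matched       = matched′
        ; fewer-X       = +-cancelʳ-≤ 1 _ _ (begin
            #unplacedX s′ + 1      ≡⟨ cong (_+ 1) (#unplacedX-attach-Y y∈Y) ⟩
            #unplacedX initial + 1 ≡⟨ #unplacedX-initial ⟩
            _                      ≤⟨ X≤Y ⟩
            _                      ≡⟨ trans (sym #unplacedY-initial) (sym (#unplacedY-attach-Y y∈Y)) ⟩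
            #unplacedY s′ + 1      ∎)
        ; Y-demand      = +-cancelʳ-≤ 1 _ _ (begin
            freeY s′ + pendingY s′ + 1        ≡⟨ cong (λ m → m + pendingY s′ + 1) freeY₁ ⟩
            (d y ∸ 1) + pendingY s′ + 1       ≡⟨ cong (_+ 1) (trans (+-comm (d y ∸ 1) _) (pendingY-attach-Y y∈Y)) ⟩
            pendingY initial + 1              ≡⟨ cong (_+ 1) pendingY-initial ⟩
            _                                 ≤⟨ Y-excess ⟩
            _                                 ≡⟨ trans (sym #unplacedX-initial) (cong (_+ 1) (sym (#unplacedX-attach-Y y∈Y))) ⟩
            #unplacedX s′ + 1                 ∎)
        ; pending⇒freeY = pending⇒freeY′ y-choice
        ; X-left⇒free   = λ _ → +-cancelʳ-≤ 1 1 (freeAll s′) (begin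
            2                             ≤⟨ X-degree root root∈X ⟩
            d root                        ≡⟨ free-initial-root ⟨
            free initial root             ≤⟨ term≤sumFin (free initial) root ⟩
            freeAll initial               ≤⟨ m≤m+n (freeAll initial) (slots y) ⟩
            freeAll initial + slots y     ≡⟨ Σfree-attach root-free (λ _ → true) ⟨
            freeAll s′ + 1                ∎)
        }
        where
        open ≤-Reasoning
        matched′ : Matched s′
        matched′ x x-placed x∈X with placed-cases x-placed
        ... | inj₁ refl = ⊥-elim (true≢false (trans (sym x∈X) y∈Y))
        ... | inj₂ (_ , x-placed₀) with placed-initial {x} x-placed₀
        ...   | refl = y , placed-v , v≢root , parent-v , y∈Y
        pending⇒freeY′ : (2 ≤ d y ⊎ ∀ j → Unplaced initial j × inX j ≡ false → ¬ 2 ≤ d j) →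
                         1 ≤ pendingY s′ → 1 ≤ freeY s′
        pending⇒freeY′ (inj₁ 2≤dy) _   = subst (1 ≤_) (sym freeY₁) (∸-monoˡ-≤ 1 2≤dy)
        pending⇒freeY′ (inj₂ small) pos = ⊥-elim (1+n≰n (begin
          1                           ≤⟨ pos ⟩
          pendingY s′                 ≤⟨ m≤m+n (pendingY s′) (d y ∸ 1) ⟩
          pendingY s′ + (d y ∸ 1)     ≡⟨ pendingY-attach-Y y∈Y ⟩
          pendingY initial            ≡⟨ no-pendingY initial small ⟩
          0                           ∎))

    start : Σ State Growing
    start with choose-preferring (λ i → (placed initial i Bool.≟ false) ×-dec (inX i Bool.≟ false))
                                 (λ i → 2 ≤? d i) Y-exists
      where
      Y-exists : ∃ λ i → Unplaced initial i × inX i ≡ false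
      Y-exists with unplaced-with initial inY (≤-trans 1≤#X (subst (_ ≤_) (sym #unplacedY-initial) X≤Y))
      ... | i , i-unplaced , i∈Y = i , i-unplaced , Bool.not-injective i∈Y
    ... | y , (y-unplaced , y∈Y) , y-choice = attach initial y root , Start.growing y-unplaced y∈Y y-choice

    module Grow {s} (growing : Growing s) (X-left : 1 ≤ #unplacedX s)
                {x} (x-unplaced : Unplaced s x) (x∈X : inX x ≡ true)
                (x-choice : 3 ≤ d x ⊎ ∀ j → Unplaced s j × inX j ≡ true → ¬ 3 ≤ d j)
                {y} (y-unplaced : Unplaced s y) (y∈Y : inX y ≡ false)
                (y-choice : 2 ≤ d y ⊎ ∀ j → Unplaced s j × inX j ≡ false → ¬ 2 ≤ d j)
                {u} (u-placed : Placed s u) (u-free : 1 ≤ free s u)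
                (u-choice : (inX u ≡ false × 1 ≤ freeY s) ⊎ (inX u ≡ true × freeY s ≡ 0)) where

      open Growing growing

      module A₁ = Attach valid {x} {u} x-unplaced u-placed

      s₁ : State
      s₁ = A₁.s′

      valid₁ : Valid s₁
      valid₁ = A₁.valid-attach u-free (inj₁ x∈X)

      y-unplaced₁ : Unplaced s₁ y
      y-unplaced₁ = trans (A₁.placed-≢ y≢x) y-unplaced
        where
        y≢x : y ≢ x
        y≢x refl = true≢false (trans (sym x∈X) y∈Y)

      slots-x : slots x ≡ d x ∸ 1
      slots-x = slots-nonroot A₁.v≢root

      x-free₁ : 1 ≤ free s₁ x
      x-free₁ = subst (1 ≤_) (sym (trans A₁.free-v slots-x)) (∸-monoˡ-≤ 1 (X-degree x x∈X))

      module A₂ = Attach valid₁ {y} {x} y-unplaced₁ A₁.placed-v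

      s₂ : State
      s₂ = A₂.s′

      slots-y : slots y ≡ d y ∸ 1
      slots-y = slots-nonroot A₂.v≢root

      #unplaced₂ : #unplaced s₂ + 2 ≡ #unplaced s
      #unplaced₂ = trans (sym (+-assoc _ 1 1)) (trans (cong (_+ 1) A₂.#unplaced-attach) A₁.#unplaced-attach)

      #unplacedX₂ : #unplacedX s₂ + 1 ≡ #unplacedX s
      #unplacedX₂ = trans (cong (_+ 1) (A₂.#unplacedX-attach-Y y∈Y)) (A₁.#unplacedX-attach-X x∈X)

      #unplacedY₂ : #unplacedY s₂ + 1 ≡ #unplacedY s
      #unplacedY₂ = trans (A₂.#unplacedY-attach-Y y∈Y) (A₁.#unplacedY-attach-X x∈X)

      pendingY₂ : pendingY s₂ + (d y ∸ 1) ≡ pendingY s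
      pendingY₂ = trans (A₂.pendingY-attach-Y y∈Y) (A₁.pendingY-attach-X x∈X)

      freeAll₂ : freeAll s₂ + 2 ≡ freeAll s + slots x + slots y
      freeAll₂ = begin
        freeAll s₂ + 2             ≡⟨ +-assoc (freeAll s₂) 1 1 ⟨
        freeAll s₂ + 1 + 1         ≡⟨ cong (_+ 1) (A₂.Σfree-attach x-free₁ (λ _ → true)) ⟩
        freeAll s₁ + slots y + 1   ≡⟨ solve 3 (λ a b c → a :+ b :+ c := a :+ c :+ b) refl (freeAll s₁) (slots y) 1 ⟩
        freeAll s₁ + 1 + slots y   ≡⟨ cong (_+ slots y) (A₁.Σfree-attach u-free (λ _ → true)) ⟩
        freeAll s + slots x + slots y ∎
        where open ≡-Reasoning

      freeY₁ : freeY s₁ + 𝟙 (inY u) ≡ freeY s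
      freeY₁ = trans (A₁.Σfree-attach u-free inY)
                     (trans (cong (λ b → freeY s + when (not b) (slots x)) x∈X) (+-identityʳ _))

      freeY₂ : freeY s₂ ≡ freeY s₁ + (d y ∸ 1)
      freeY₂ = begin
        freeY s₂                                ≡⟨ +-identityʳ _ ⟨
        freeY s₂ + 0                            ≡⟨ cong (λ b → freeY s₂ + 𝟙 (not b)) x∈X ⟨
        freeY s₂ + 𝟙 (inY x)                    ≡⟨ A₂.Σfree-attach x-free₁ inY ⟩
        freeY s₁ + when (inY y) (slots y)       ≡⟨ cong₂ (λ b m → freeY s₁ + when (not b) m) y∈Y slots-y ⟩
        freeY s₁ + (d y ∸ 1)                    ∎
        where open ≡-Reasoning

      matched₂ : Matched s₂
      matched₂ x′ x′-placed x′∈X with A₂.placed-cases x′-placed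
      ... | inj₁ refl = ⊥-elim (true≢false (trans (sym x′∈X) y∈Y))
      ... | inj₂ (_ , x′-placed₁) with A₁.placed-cases x′-placed₁
      ...   | inj₁ refl = y , A₂.placed-v , A₂.v≢root , A₂.parent-v , y∈Y
      ...   | inj₂ (_ , x′-placed₀) with matched x′ x′-placed₀ x′∈X
      ...     | j , via = j , A₂.keeps-matched (A₁.keeps-matched via)

      fewer-X₂ : #unplacedX s₂ ≤ #unplacedY s₂
      fewer-X₂ = +-cancelʳ-≤ 1 _ _ (subst₂ _≤_ (sym #unplacedX₂) (sym #unplacedY₂) fewer-X)

      unplaced₂⇒unplaced : ∀ {i} → Unplaced s₂ i → Unplaced s i
      unplaced₂⇒unplaced i-unplaced₂ = proj₁ (A₁.unplaced-before (proj₁ (A₂.unplaced-before i-unplaced₂)))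

      pendingY≤ : pendingY s₂ ≤ pendingY s
      pendingY≤ = subst (pendingY s₂ ≤_) pendingY₂ (m≤m+n _ _)

      Y-demand₂ : freeY s₂ + pendingY s₂ ≤ #unplacedX s₂
      Y-demand₂ = via u-choice
        where
        via : (inX u ≡ false × 1 ≤ freeY s) ⊎ (inX u ≡ true × freeY s ≡ 0) →
              freeY s₂ + pendingY s₂ ≤ #unplacedX s₂
        via (inj₁ (u∈Y , _)) = +-cancelʳ-≤ 1 _ _ (begin
          freeY s₂ + pendingY s₂ + 1
            ≡⟨ cong (λ m → m + pendingY s₂ + 1) freeY₂ ⟩
          freeY s₁ + (d y ∸ 1) + pendingY s₂ + 1
            ≡⟨ solve 4 (λ a b c e → a :+ b :+ c :+ e := (a :+ e) :+ (c :+ b)) refl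
                 (freeY s₁) (d y ∸ 1) (pendingY s₂) 1 ⟩
          (freeY s₁ + 1) + (pendingY s₂ + (d y ∸ 1))
            ≡⟨ cong₂ _+_ (trans (cong (λ b → freeY s₁ + 𝟙 (not b)) (sym u∈Y)) freeY₁) pendingY₂ ⟩
          freeY s + pendingY s
            ≤⟨ Y-demand ⟩
          #unplacedX s
            ≡⟨ #unplacedX₂ ⟨
          #unplacedX s₂ + 1 ∎)
          where open ≤-Reasoning
        via (inj₂ (u∈X , freeY≡0)) = ≤-trans (≤-reflexive nothing-left) z≤n
          where
          pending≡0 : pendingY s ≡ 0
          pending≡0 = n<1⇒n≡0 (≰⇒> (λ pos → 1+n≰n (subst (1 ≤_) freeY≡0 (pending⇒freeY pos))))
          freeY₁≡0 : freeY s₁ ≡ 0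
          freeY₁≡0 = trans (sym (+-identityʳ _))
                           (trans (cong (λ b → freeY s₁ + 𝟙 (not b)) (sym u∈X)) (trans freeY₁ freeY≡0))
          nothing-left : freeY s₂ + pendingY s₂ ≡ 0
          nothing-left = cong₂ _+_
            (trans freeY₂ (cong₂ _+_ freeY₁≡0 (m+n≡0⇒n≡0 (pendingY s₂) (trans pendingY₂ pending≡0))))
            (m+n≡0⇒m≡0 (pendingY s₂) (trans pendingY₂ pending≡0))

      pending⇒freeY₂ : 1 ≤ pendingY s₂ → 1 ≤ freeY s₂
      pending⇒freeY₂ pos = via u-choice y-choice
        where
        via : (inX u ≡ false × 1 ≤ freeY s) ⊎ (inX u ≡ true × freeY s ≡ 0) →
              (2 ≤ d y ⊎ ∀ j → Unplaced s j × inX j ≡ false → ¬ 2 ≤ d j) → 1 ≤ freeY s₂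
        via (inj₂ (_ , freeY≡0)) _ =
          ⊥-elim (1+n≰n (subst (1 ≤_) freeY≡0 (pending⇒freeY (≤-trans pos pendingY≤))))
        via (inj₁ _) (inj₂ small) =
          ⊥-elim (1+n≰n (subst (1 ≤_) (no-pendingY s small) (≤-trans pos pendingY≤)))
        via (inj₁ _) (inj₁ 2≤dy) =
          subst (1 ≤_) (sym freeY₂) (≤-trans (∸-monoˡ-≤ 1 2≤dy) (m≤n+m (d y ∸ 1) (freeY s₁)))

      two-new-slots : 2 ≤ slots x + slots y → 1 ≤ freeAll s₂
      two-new-slots 2≤ = +-cancelʳ-≤ 2 1 (freeAll s₂) (begin
        1 + 2                           ≤⟨ +-mono-≤ (X-left⇒free X-left) 2≤ ⟩
        freeAll s + (slots x + slots y) ≡⟨ +-assoc (freeAll s) _ _ ⟨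
        freeAll s + slots x + slots y   ≡⟨ freeAll₂ ⟨
        freeAll s₂ + 2                  ∎)
        where open ≤-Reasoning

      X-left⇒free₂ : 1 ≤ #unplacedX s₂ → 1 ≤ freeAll s₂
      X-left⇒free₂ X-left₂ = via x-choice y-choice
        where
        via : (3 ≤ d x ⊎ ∀ j → Unplaced s j × inX j ≡ true → ¬ 3 ≤ d j) →
              (2 ≤ d y ⊎ ∀ j → Unplaced s j × inX j ≡ false → ¬ 2 ≤ d j) → 1 ≤ freeAll s₂
        via (inj₁ 3≤dx) _ =
          two-new-slots (≤-trans (subst (2 ≤_) (sym slots-x) (∸-monoˡ-≤ 1 3≤dx)) (m≤m+n (slots x) (slots y)))
        via (inj₂ _) (inj₁ 2≤dy) =
          two-new-slots (+-mono-≤ (subst (1 ≤_) (sym slots-x) (∸-monoˡ-≤ 1 (X-degree x x∈X)))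
                                  (subst (1 ≤_) (sym slots-y) (∸-monoˡ-≤ 1 2≤dy)))
        via (inj₂ small-X) (inj₂ small-Y) =
          ≤-trans X-left₂ (≤-trans fewer-X₂ (Y≤freeAll (A₂.valid-attach x-free₁ (inj₂ x∈X)) small))
          where
          small : ∀ {i} → Unplaced s₂ i → d i + 𝟙 (inY i) ≤ 2
          small {i} i-unplaced₂ with inX i in eq
          ... | true  = ≤-trans (≤-reflexive (+-identityʳ (d i)))
                                (≤-pred (≰⇒> (small-X i (unplaced₂⇒unplaced i-unplaced₂ , eq))))
          ... | false = +-monoˡ-≤ 1 (≤-pred (≰⇒> (small-Y i (unplaced₂⇒unplaced i-unplaced₂ , eq))))

      growing₂ : Growing s₂
      growing₂ = record
        { valid         = A₂.valid-attach x-free₁ (inj₂ x∈X)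
        ; matched       = matched₂
        ; fewer-X       = fewer-X₂
        ; Y-demand      = Y-demand₂
        ; pending⇒freeY = pending⇒freeY₂
        ; X-left⇒free   = X-left⇒free₂
        }

      shrinks : #unplaced s₂ < #unplaced s
      shrinks = subst (#unplaced s₂ <_) #unplaced₂ (m<m+n (#unplaced s₂) (s≤s z≤n))

    free-slot : ∀ {s} → Growing s → 1 ≤ #unplacedX s → ∃ λ u → Placed s u × 1 ≤ free s u ×
                ((inX u ≡ false × 1 ≤ freeY s) ⊎ (inX u ≡ true × freeY s ≡ 0))
    free-slot {s} growing X-left with 1 ≤? freeY s
    ... | yes Y-free with Σfree-positive (Growing.valid growing) inY Y-free
    ...   | u , u-placed , u∈Y , u-free = u , u-placed , u-free , inj₁ (Bool.not-injective u∈Y , Y-free)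
    free-slot {s} growing X-left | no no-Y-free
      with Σfree-positive (Growing.valid growing) inX
             (subst (1 ≤_) (trans (freeAll-split s) (trans (cong (freeX s +_) freeY≡0) (+-identityʳ _)))
                    (Growing.X-left⇒free growing X-left))
      where freeY≡0 = n<1⇒n≡0 (≰⇒> no-Y-free)
    ... | u , u-placed , u∈X , u-free = u , u-placed , u-free , inj₂ (u∈X , n<1⇒n≡0 (≰⇒> no-Y-free))

    grow : ∀ s → Growing s → 1 ≤ #unplacedX s → Σ State (λ s′ → Growing s′ × #unplaced s′ < #unplaced s)
    grow s growing X-left
      with choose-preferring (λ i → (placed s i Bool.≟ false) ×-dec (inX i Bool.≟ true)) (λ i → 3 ≤? d i)
                             (unplaced-with s inX X-left)
         | choose-preferring (λ i → (placed s i Bool.≟ false) ×-dec (inX i Bool.≟ false)) (λ i → 2 ≤? d i)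
                             Y-left
         | free-slot growing X-left
      where
      Y-left : ∃ λ i → Unplaced s i × inX i ≡ false
      Y-left with unplaced-with s inY (≤-trans X-left (Growing.fewer-X growing))
      ... | i , i-unplaced , i∈Y = i , i-unplaced , Bool.not-injective i∈Y
    ... | x , (x-unplaced , x∈X) , x-choice | y , (y-unplaced , y∈Y) , y-choice | u , u-placed , u-free , u-choice
      = G.s₂ , G.growing₂ , G.shrinks
      where
      module G = Grow growing X-left x-unplaced x∈X x-choice y-unplaced y∈Y y-choice u-placed u-free u-choice

    record Finishing (s : State) : Set where
      field
        valid     : Valid s
        matched   : Matched s
        no-freeY  : freeY s ≡ 0
        only-Y-leaves : ∀ {i} → Unplaced s i → inX i ≡ false × d i ≡ 1

    growing⇒finishing : ∀ {s} → Growing s → #unplacedX s ≡ 0 → Finishing s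
    growing⇒finishing {s} growing no-X = record
      { valid         = valid
      ; matched       = matched
      ; no-freeY      = m+n≡0⇒m≡0 (freeY s) nothing-left
      ; only-Y-leaves = only-Y-leaves
      }
      where
      open Growing growing
      nothing-left : freeY s + pendingY s ≡ 0
      nothing-left = n≤0⇒n≡0 (subst (freeY s + pendingY s ≤_) no-X Y-demand)
      only-Y-leaves : ∀ {i} → Unplaced s i → inX i ≡ false × d i ≡ 1
      only-Y-leaves {i} i-unplaced = i∈Y , ≤-antisym (m∸n≡0⇒m≤n leaf) (d-positive i)
        where
        i∈Y = 𝟙≡0 (Σunplaced≡0 s (λ i → 𝟙 (inX i)) no-X i-unplaced)
        leaf : d i ∸ 1 ≡ 0
        leaf = trans (cong (λ b → when (not b) (d i ∸ 1)) (sym i∈Y))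
                     (Σunplaced≡0 s (λ i → when (inY i) (d i ∸ 1)) (m+n≡0⇒n≡0 (freeY s) nothing-left) i-unplaced)

    X-slot : ∀ {s} → Finishing s → ∀ {v} → Unplaced s v → 1 ≤ freeX s
    X-slot {s} finishing {v} v-unplaced = begin
      1              ≡⟨ cong (λ b → when (not b) 1) v-unplaced ⟨
      when (not (placed s v)) 1 ≤⟨ term≤sumFin (λ i → when (not (placed s i)) 1) v ⟩
      #unplaced s    ≡⟨ freeAll≡#unplaced ⟨
      freeAll s      ≡⟨ freeAll-split s ⟩
      freeX s + freeY s ≡⟨ trans (cong (freeX s +_) no-freeY) (+-identityʳ _) ⟩
      freeX s        ∎
      where
      open ≤-Reasoning
      open Finishing finishing
      freeAll≡#unplaced : freeAll s ≡ #unplaced s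
      freeAll≡#unplaced = +-cancelʳ-≡ (#unplaced s) _ _
        (trans (cong (freeAll s +_) (sym (Σunplaced-cong s (λ i-unplaced → proj₂ (only-Y-leaves i-unplaced)))))
               (balance valid))

    finish-step : ∀ {s} → Finishing s → ∀ {v} → Unplaced s v →
                  Σ State (λ s′ → Finishing s′ × #unplaced s′ < #unplaced s)
    finish-step {s} finishing {v} v-unplaced with Σfree-positive (Finishing.valid finishing) inX (X-slot finishing v-unplaced)
    ... | u , u-placed , u∈X , u-free = s′ , finishing′ , subst (#unplaced s′ <_) #unplaced-attach (m<m+n _ (s≤s z≤n))
      where
      open Finishing finishing
      open Attach valid {v} {u} v-unplaced u-placed
      v∈Y : inX v ≡ false
      v∈Y = proj₁ (only-Y-leaves v-unplaced)
      finishing′ : Finishing s′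
      finishing′ = record
        { valid         = valid-attach u-free (inj₂ u∈X)
        ; matched       = matched′
        ; no-freeY      = begin
            freeY s′                                ≡⟨ +-identityʳ _ ⟨
            freeY s′ + 0                            ≡⟨ cong (λ b → freeY s′ + 𝟙 (not b)) u∈X ⟨
            freeY s′ + 𝟙 (inY u)                    ≡⟨ Σfree-attach u-free inY ⟩
            freeY s + when (inY v) (slots v)        ≡⟨ cong₂ (λ m b → m + when (not b) (slots v)) no-freeY v∈Y ⟩
            slots v                                 ≡⟨ slots-nonroot v≢root ⟩
            d v ∸ 1                                 ≡⟨ cong (_∸ 1) (proj₂ (only-Y-leaves v-unplaced)) ⟩
            0                                       ∎
        ; only-Y-leaves = λ i-unplaced → only-Y-leaves (proj₁ (unplaced-before i-unplaced))
        }
        where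
        open ≡-Reasoning
        matched′ : Matched s′
        matched′ x x-placed x∈X with placed-cases x-placed
        ... | inj₁ refl = ⊥-elim (true≢false (trans (sym x∈X) v∈Y))
        ... | inj₂ (_ , x-placed₀) with matched x x-placed₀ x∈X
        ...   | j , via = j , keeps-matched via

    grow-progress : ∀ s → Growing s → #unplacedX s ≡ 0 ⊎ Σ State (λ s′ → Growing s′ × #unplaced s′ < #unplaced s)
    grow-progress s growing with 1 ≤? #unplacedX s
    ... | yes X-left = inj₂ (grow s growing X-left)
    ... | no  no-X   = inj₁ (n<1⇒n≡0 (≰⇒> no-X))

    finish-progress : ∀ s → Finishing s →
                      (∀ i → Placed s i) ⊎ Σ State (λ s′ → Finishing s′ × #unplaced s′ < #unplaced s)
    finish-progress s finishing with any? (λ i → placed s i Bool.≟ false)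
    ... | yes (v , v-unplaced) = inj₂ (finish-step finishing v-unplaced)
    ... | no  all-placed       = inj₁ (λ i → Bool.¬-not (λ i-unplaced → all-placed (i , i-unplaced)))

    complete : Completed
    complete with iterate #unplaced grow-progress (proj₁ start) (proj₂ start)
    ... | s , growing , no-X with iterate #unplaced finish-progress s (growing⇒finishing growing no-X)
    ...   | s′ , finishing , all-placed = s′ , Finishing.valid finishing , Finishing.matched finishing , all-placed

    realisation : Realisation
    realisation = completed⇒realisation complete

sumIn-as-sumFin : ∀ {n} (X : Subset n) f → sumIn X f ≡ sumFin (λ i → when (lookup X i) (f i))
sumIn-as-sumFin []          f = refl
sumIn-as-sumFin (true ∷ X)  f = cong (f zero +_) (sumIn-as-sumFin X (λ i → f (suc i)))
sumIn-as-sumFin (false ∷ X) f = sumIn-as-sumFin X (λ i → f (suc i))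

sumOut-as-sumFin : ∀ {n} (X : Subset n) f → sumOut X f ≡ sumFin (λ i → when (not (lookup X i)) (f i))
sumOut-as-sumFin []          f = refl
sumOut-as-sumFin (true ∷ X)  f = sumOut-as-sumFin X (λ i → f (suc i))
sumOut-as-sumFin (false ∷ X) f = cong (f zero +_) (sumOut-as-sumFin X (λ i → f (suc i)))

connected-degree : ∀ {m} (G : Graph (suc (suc m))) → Connected G → ∀ v → 1 ≤ deg G v
connected-degree G connected zero    = walk-degree (connected zero (suc zero)) (λ ())
connected-degree G connected (suc v) = walk-degree (connected (suc v) zero) (λ ())

tree-sequence-positive : ∀ {m d} → TreeDegreeSequence (suc (suc m)) d → ∀ i → 1 ≤ d i
tree-sequence-positive (_ , T , tree , π , degrees) i =
  subst (1 ≤_) (degrees i) (connected-degree T (proj₁ tree) (π ⟨$⟩ʳ i))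

tree-sequence-sum : ∀ {n d} → TreeDegreeSequence (suc n) d → sumFin d + 2 ≡ suc n + suc n
tree-sequence-sum (_ , T , tree , π , degrees) =
  trans (cong (_+ 2) (trans (sumFin-cong (λ i → sym (degrees i))) (sumFin-permute (deg T) π)))
        (tree-degree-sum T tree)

1≤m+m⇒1≤m : ∀ {m} → 1 ≤ m + m → 1 ≤ m
1≤m+m⇒1≤m {suc m} _ = s≤s z≤n

heavy⇒nonempty : ∀ {n} (X : Subset n) (d : Fin n → ℕ) → 1 ≤ sumFin d →
                 sumOut X d ≤ sumIn X d → ∃ λ r → lookup X r ≡ true
heavy⇒nonempty X d 1≤Σd Y≤X with sumFin-positive (λ i → when (lookup X i) (d i)) (1≤m+m⇒1≤m (begin
  1          ≤⟨ 1≤Σd ⟩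
  sumFin d   ≡⟨ sumFin-when-split (lookup X) d ⟨
  SX + SY    ≤⟨ +-monoʳ-≤ SX (subst₂ _≤_ (sumOut-as-sumFin X d) (sumIn-as-sumFin X d) Y≤X) ⟩
  SX + SX    ∎))
  where
  open ≤-Reasoning
  SX = sumFin (λ i → when (lookup X i) (d i))
  SY = sumFin (λ i → when (not (lookup X i)) (d i))
... | r , pos = r , proj₁ (when-positive pos)

small⇒fewer : ∀ {n} (X : Subset n) → 2 * ∣ X ∣ ≤ n →
              sumFin (λ i → 𝟙 (lookup X i)) ≤ sumFin (λ i → 𝟙 (not (lookup X i)))
small⇒fewer {n} X 2∣X∣≤n = +-cancelˡ-≤ kX _ _ (begin
  kX + kX        ≡⟨ cong₂ _+_ (card≡sumFin X) (card≡sumFin X) ⟨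
  ∣ X ∣ + ∣ X ∣   ≡⟨ cong (∣ X ∣ +_) (+-identityʳ ∣ X ∣) ⟨
  2 * ∣ X ∣       ≤⟨ 2∣X∣≤n ⟩
  n              ≡⟨ trans (sumFin-when-split (lookup X) (λ _ → 1)) (sumFin-one n) ⟨
  kX + kY        ∎)
  where
  open ≤-Reasoning
  kX = sumFin (λ i → 𝟙 (lookup X i))
  kY = sumFin (λ i → 𝟙 (not (lookup X i)))

lemma2 : (n : ℕ) (d : Fin n → ℕ) → TreeDegreeSequence n d → 3 ≤ n →
         (X : Subset n) →
         (∀ i → i ∈ X → 1 < d i) →
         2 * ∣ X ∣ ≤ n →
         sumIn X d ≥ sumOut X d →
         Σ (Graph n) (λ T → IsTree T × (∀ i → deg T i ≡ d i) × MinimumVertexCover T X)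
lemma2 zero                _ _ ()
lemma2 (suc zero)          _ _ (s≤s ())
lemma2 (suc (suc m)) d tds _ X X-degree X-small X-heavy
  with heavy⇒nonempty X d (≤-trans (tree-sequence-positive tds zero) (term≤sumFin d zero)) X-heavy
... | r , r∈X = minimum-cover realisation
  where
  open Construction d (lookup X) r (tree-sequence-positive tds)
  open Phases (tree-sequence-sum tds) (λ i i∈X → X-degree i (lookup⇒[]= i X i∈X)) r∈X
              (small⇒fewer X X-small) (subst₂ _≤_ (sumOut-as-sumFin X d) (sumIn-as-sumFin X d) X-heavy)
  minimum-cover : Realisation → Σ (Graph _) (λ T → IsTree T × (∀ i → deg T i ≡ d i) × MinimumVertexCover T X)
  minimum-cover (T , tree , degrees , cover , back , matching) =
    T , tree , degrees , matched-cover-minimum T X back matching′ cover′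
    where
    cover′ : VertexCover T X
    cover′ i j e = Sum.map (lookup⇒[]= i X) (lookup⇒[]= j X) (cover i j e)
    matching′ : ∀ x → x ∈ X → ∃ λ j → Adj T x j × j ∉ X × back j ≡ x
    matching′ x x∈X with matching x ([]=⇒lookup x∈X)
    ... | j , e , j∈Y , back-j = j , e , (λ j∈X → true≢false (trans (sym ([]=⇒lookup j∈X)) j∈Y)) , back-j
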